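{- The merge rule $(mrg)$: from $\mathcal{G}/\!/\Gamma_1\vdash\Delta_1/\!/\Gamma_2\vdash\Delta_2/\!/\mathcal{H}$ infer $\mathcal{G}/\!/\Gamma_1,\Gamma_2\vdash\Delta_1,\Delta_2/\!/\mathcal{H}$, is admissible in $\mathsf{LNIF}$: if the premise is derivable in $\mathsf{LNIF}$, so is the conclusion.
   Context: Formulae are first-order over $\bot,\land,\lor,\supset,\forall,\exists$; in sequents bound variables $x,y,\dots$ are distinct from parameters $a,b,\dots$, which occupy all free positions; $A[a/x]$ replaces free occurrences of $x$ by $a$; $p(\vec a)$ is an atomic formula with parameters $\vec a$. A linear nested sequent is $\Gamma_1\vdash\Delta_1 /\!/ \cdots /\!/ \Gamma_n\vdash\Delta_n$ ($n\ge1$), each $\Gamma_i,\Delta_i$ a finite, possibly empty, multiset of formulae (a component). In rule schemas, $\mathcal{G},\mathcal{H},\mathcal{F}$ denote possibly empty sequences of components. $\mathsf{LNIF}$ has the rules (from premise(s) infer conclusion): Initial: $(id_1)$ $\mathcal{G}/\!/\Gamma,p(\vec a)\vdash p(\vec a),\Delta/\!/\mathcal{H}$; $(id_2)$ $\mathcal{G}/\!/\Gamma_1,p(\vec a)\vdash\Delta_1/\!/\mathcal{H}/\!/\Gamma_2\vdash p(\vec a),\Delta_2/\!/\mathcal{F}$; $(\bot_l)$ $\mathcal{G}/\!/\Gamma,\bot\vdash\Delta/\!/\mathcal{H}$. $(\land_l)$: from $\mathcal{G}/\!/\Gamma,A,B\vdash\Delta/\!/\mathcal{H}$ infer $\mathcal{G}/\!/\Gamma,A\land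 B\vdash\Delta/\!/\mathcal{H}$. $(\lor_r)$: from $\mathcal{G}/\!/\Gamma\vdash\Delta,A,B/\!/\mathcal{H}$ infer $\mathcal{G}/\!/\Gamma\vdash\Delta,A\lor B/\!/\mathcal{H}$. $(\land_r)$: from $\mathcal{G}/\!/\Gamma\vdash\Delta,A/\!/\mathcal{H}$ and $\mathcal{G}/\!/\Gamma\vdash\Delta,B/\!/\mathcal{H}$ infer $\mathcal{G}/\!/\Gamma\vdash\Delta,A\land B/\!/\mathcal{H}$. $(\lor_l)$: from $\mathcal{G}/\!/\Gamma,A\vdash\Delta/\!/\mathcal{H}$ and $\mathcal{G}/\!/\Gamma,B\vdash\Delta/\!/\mathcal{H}$ infer $\mathcal{G}/\!/\Gamma,A\lor B\vdash\Delta/\!/\mathcal{H}$. $(\supset_{r1})$: from $\mathcal{G}/\!/\Gamma\vdash\Delta/\!/A\vdash B$ infer $\mathcal{G}/\!/\Gamma\vdash\Delta,A\supset B$. $(\supset_l)$: from $\mathcal{G}/\!/\Gamma,B\vdash\Delta/\!/\mathcal{H}$ and $\mathcal{G}/\!/\Gamma,A\supset B\vdash A,\Delta/\!/\mathcal{H}$ infer $\mathcal{G}/\!/\Gamma,A\supset B\vdash\Delta/\!/\mathcal{H}$. $(lift)$: from $\mathcal{G}/\!/\Gamma_1,A\vdash\Delta_1/\!/\Gamma_2,A\vdash\Delta_2/\!/\mathcal{H}$ infer $\mathcal{G}/\!/\Gamma_1,A\vdash\Delta_1/\!/\Gamma_2\vdash\Delta_2/\!/\mathcal{H}$. $(\forall_l)$: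 from $\mathcal{G}/\!/\Gamma,A[a/x],\forall xA\vdash\Delta/\!/\mathcal{H}$ infer $\mathcal{G}/\!/\Gamma,\forall xA\vdash\Delta/\!/\mathcal{H}$ ($a$ any parameter). $(\forall_{r1})$: from $\mathcal{G}/\!/\Gamma\vdash\Delta/\!/\ \vdash A[a/x]$ infer $\mathcal{G}/\!/\Gamma\vdash\Delta,\forall xA$. $(\exists_l)$: from $\mathcal{G}/\!/\Gamma,A[a/x]\vdash\Delta/\!/\mathcal{H}$ infer $\mathcal{G}/\!/\Gamma,\exists xA\vdash\Delta/\!/\mathcal{H}$. $(\exists_r)$: from $\mathcal{G}/\!/\Gamma\vdash A[a/x],\exists xA,\Delta/\!/\mathcal{H}$ infer $\mathcal{G}/\!/\Gamma\vdash\exists xA,\Delta/\!/\mathcal{H}$ ($a$ any parameter). $(\supset_{r2})$: from $\mathcal{G}/\!/\Gamma_1\vdash\Delta_1/\!/A\vdash B/\!/\Gamma_2\vdash\Delta_2/\!/\mathcal{H}$ and $\mathcal{G}/\!/\Gamma_1\vdash\Delta_1/\!/\Gamma_2\vdash\Delta_2,A\supset B/\!/\mathcal{H}$ infer $\mathcal{G}/\!/\Gamma_1\vdash\Delta_1,A\supset B/\!/\Gamma_2\vdash\Delta_2/\!/\mathcal{H}$. $(\forall_{r2})$: from $\mathcal{G}/\!/\Gamma_1\vdash\Delta_1/\!/\ \vdash A[a/x]/\!/\Gamma_2\vdash\Delta_2/\!/\mathcal{H}$ and $\mathcal{G}/\!/\Gamma_1\vdash\Delta_1/\!/\Gamma_2\vdash\Delta_2,\forall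 xA/\!/\mathcal{H}$ infer $\mathcal{G}/\!/\Gamma_1\vdash\Delta_1,\forall xA/\!/\Gamma_2\vdash\Delta_2/\!/\mathcal{H}$. In $(\forall_{r1}),(\exists_l),(\forall_{r2})$, $a$ is an eigenvariable (does not occur in the conclusion). -}

module Defs where

open import Data.Nat using (ℕ; _≡ᵇ_)
open import Data.Bool using (if_then_else_)
open import Data.List using (List; []; _∷_; _++_; [_]; concatMap)
open import Data.List.Membership.Propositional using (_∈_; _∉_)
open import Data.List.Relation.Unary.All using (All)
open import Data.List.Relation.Binary.Pointwise using (Pointwise)
open import Data.List.Relation.Binary.Permutation.Propositional using (_↭_)
open import Data.Product using (_×_)
open import Data.Unit using (⊤)

-- Bound variables and parameters are two disjoint sorts, both named by ℕ.
Var : Set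
Var = ℕ

Par : Set
Par = ℕ

Pred : Set
Pred = ℕ

data Term : Set where
  var : Var → Term
  par : Par → Term

data Formula : Set where
  atom : Pred → List Term → Formula
  ⊥'   : Formula
  _∧'_ : Formula → Formula → Formula
  _∨'_ : Formula → Formula → Formula
  _⊃_  : Formula → Formula → Formula
  ∀'   : Var → Formula → Formula
  ∃'   : Var → Formula → Formula

patom : Pred → List Par → Formula
patom p as = atom p (Data.List.map par as)

substT : Par → Var → Term → Term
substT a x (var y) = if x ≡ᵇ y then par a else var y
substT a x (par b) = par b

substTs : Par → Var → List Term → List Term
substTs a x []       = []
substTs a x (t ∷ ts) = substT a x t ∷ substTs a x ts

_[_/_] : Formula → Par → Var → Formula
atom p ts [ a / x ] = atom p (substTs a x ts)
⊥'        [ a / x ] = ⊥'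
(A ∧' B)  [ a / x ] = (A [ a / x ]) ∧' (B [ a / x ])
(A ∨' B)  [ a / x ] = (A [ a / x ]) ∨' (B [ a / x ])
(A ⊃ B)   [ a / x ] = (A [ a / x ]) ⊃ (B [ a / x ])
∀' y A    [ a / x ] = if x ≡ᵇ y then ∀' y A else ∀' y (A [ a / x ])
∃' y A    [ a / x ] = if x ≡ᵇ y then ∃' y A else ∃' y (A [ a / x ])

parsT : Term → List Par
parsT (var x) = []
parsT (par a) = a ∷ []

parsF : Formula → List Par
parsF (atom p ts) = concatMap parsT ts
parsF ⊥'          = []
parsF (A ∧' B)    = parsF A ++ parsF B
parsF (A ∨' B)    = parsF A ++ parsF B
parsF (A ⊃ B)     = parsF A ++ parsF B
parsF (∀' x A)    = parsF A
parsF (∃' x A)    = parsF A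

ClosedT : List Var → Term → Set
ClosedT ctx (var x) = x ∈ ctx
ClosedT ctx (par a) = ⊤

ClosedF : List Var → Formula → Set
ClosedF ctx (atom p ts) = All (ClosedT ctx) ts
ClosedF ctx ⊥'          = ⊤
ClosedF ctx (A ∧' B)    = ClosedF ctx A × ClosedF ctx B
ClosedF ctx (A ∨' B)    = ClosedF ctx A × ClosedF ctx B
ClosedF ctx (A ⊃ B)     = ClosedF ctx A × ClosedF ctx B
ClosedF ctx (∀' x A)    = ClosedF (x ∷ ctx) A
ClosedF ctx (∃' x A)    = ClosedF (x ∷ ctx) A

Closed : Formula → Set
Closed = ClosedF []

-- A component Γ ⊢ Δ (multisets represented by lists, identified up to ↭)
record Comp : Set where
  constructor _⊢_
  field
    ante : List Formula
    succ : List Formula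
open Comp public

LNS : Set
LNS = List Comp

parsC : Comp → List Par
parsC (Γ ⊢ Δ) = concatMap parsF Γ ++ concatMap parsF Δ

parsS : LNS → List Par
parsS = concatMap parsC

ClosedC : Comp → Set
ClosedC (Γ ⊢ Δ) = All Closed Γ × All Closed Δ

ClosedS : LNS → Set
ClosedS = All ClosedC

_≈C_ : Comp → Comp → Set
(Γ ⊢ Δ) ≈C (Γ' ⊢ Δ') = (Γ ↭ Γ') × (Δ ↭ Δ')

_≈S_ : LNS → LNS → Set
_≈S_ = Pointwise _≈C_

infixr 5 _//_
_//_ : LNS → LNS → LNS
_//_ = _++_

-- Derivability in LNIF.  Multisets are lists; the constructor `mset`
-- expresses that sequents are taken up to multiset equality of their
-- components (it is not an extra logical rule).
data LNIF : LNS → Set where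
  mset : ∀ {S S'} → S ≈S S' → LNIF S → LNIF S'
  id₁  : ∀ G Γ Δ H p as →
         LNIF (G // [ (patom p as ∷ Γ) ⊢ (patom p as ∷ Δ) ] // H)
  id₂  : ∀ G Γ₁ Δ₁ H Γ₂ Δ₂ F p as →
         LNIF (G // [ (patom p as ∷ Γ₁) ⊢ Δ₁ ] // H // [ Γ₂ ⊢ (patom p as ∷ Δ₂) ] // F)
  ⊥l   : ∀ G Γ Δ H →
         LNIF (G // [ (⊥' ∷ Γ) ⊢ Δ ] // H)
  ∧l   : ∀ {G Γ Δ H A B} →
         LNIF (G // [ (A ∷ B ∷ Γ) ⊢ Δ ] // H) →
         LNIF (G // [ ((A ∧' B) ∷ Γ) ⊢ Δ ] // H)
  ∨r   : ∀ {G Γ Δ H A B} →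
         LNIF (G // [ Γ ⊢ (A ∷ B ∷ Δ) ] // H) →
         LNIF (G // [ Γ ⊢ ((A ∨' B) ∷ Δ) ] // H)
  ∧r   : ∀ {G Γ Δ H A B} →
         LNIF (G // [ Γ ⊢ (A ∷ Δ) ] // H) →
         LNIF (G // [ Γ ⊢ (B ∷ Δ) ] // H) →
         LNIF (G // [ Γ ⊢ ((A ∧' B) ∷ Δ) ] // H)
  ∨l   : ∀ {G Γ Δ H A B} →
         LNIF (G // [ (A ∷ Γ) ⊢ Δ ] // H) →
         LNIF (G // [ (B ∷ Γ) ⊢ Δ ] // H) →
         LNIF (G // [ ((A ∨' B) ∷ Γ) ⊢ Δ ] // H)
  ⊃r₁  : ∀ {G Γ Δ A B} →
         LNIF (G // [ Γ ⊢ Δ ] // [ (A ∷ []) ⊢ (B ∷ []) ]) →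
         LNIF (G // [ Γ ⊢ ((A ⊃ B) ∷ Δ) ])
  ⊃l   : ∀ {G Γ Δ H A B} →
         LNIF (G // [ (B ∷ Γ) ⊢ Δ ] // H) →
         LNIF (G // [ ((A ⊃ B) ∷ Γ) ⊢ (A ∷ Δ) ] // H) →
         LNIF (G // [ ((A ⊃ B) ∷ Γ) ⊢ Δ ] // H)
  lift : ∀ {G Γ₁ Δ₁ Γ₂ Δ₂ H A} →
         LNIF (G // [ (A ∷ Γ₁) ⊢ Δ₁ ] // [ (A ∷ Γ₂) ⊢ Δ₂ ] // H) →
         LNIF (G // [ (A ∷ Γ₁) ⊢ Δ₁ ] // [ Γ₂ ⊢ Δ₂ ] // H)
  ∀l   : ∀ {G Γ Δ H x A} (a : Par) →
         LNIF (G // [ ((A [ a / x ]) ∷ ∀' x A ∷ Γ) ⊢ Δ ] // H) →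
         LNIF (G // [ (∀' x A ∷ Γ) ⊢ Δ ] // H)
  ∀r₁  : ∀ {G Γ Δ x A} (a : Par) →
         a ∉ parsS (G // [ Γ ⊢ (∀' x A ∷ Δ) ]) →
         LNIF (G // [ Γ ⊢ Δ ] // [ [] ⊢ ((A [ a / x ]) ∷ []) ]) →
         LNIF (G // [ Γ ⊢ (∀' x A ∷ Δ) ])
  ∃l   : ∀ {G Γ Δ H x A} (a : Par) →
         a ∉ parsS (G // [ (∃' x A ∷ Γ) ⊢ Δ ] // H) →
         LNIF (G // [ ((A [ a / x ]) ∷ Γ) ⊢ Δ ] // H) →
         LNIF (G // [ (∃' x A ∷ Γ) ⊢ Δ ] // H)
  ∃r   : ∀ {G Γ Δ H x A} (a : Par) →
         LNIF (G // [ Γ ⊢ ((A [ a / x ]) ∷ ∃' x A ∷ Δ) ] // H) →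
         LNIF (G // [ Γ ⊢ (∃' x A ∷ Δ) ] // H)
  ⊃r₂  : ∀ {G Γ₁ Δ₁ Γ₂ Δ₂ H A B} →
         LNIF (G // [ Γ₁ ⊢ Δ₁ ] // [ (A ∷ []) ⊢ (B ∷ []) ] // [ Γ₂ ⊢ Δ₂ ] // H) →
         LNIF (G // [ Γ₁ ⊢ Δ₁ ] // [ Γ₂ ⊢ ((A ⊃ B) ∷ Δ₂) ] // H) →
         LNIF (G // [ Γ₁ ⊢ ((A ⊃ B) ∷ Δ₁) ] // [ Γ₂ ⊢ Δ₂ ] // H)
  ∀r₂  : ∀ {G Γ₁ Δ₁ Γ₂ Δ₂ H x A} (a : Par) →
         a ∉ parsS (G // [ Γ₁ ⊢ (∀' x A ∷ Δ₁) ] // [ Γ₂ ⊢ Δ₂ ] // H) →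
         LNIF (G // [ Γ₁ ⊢ Δ₁ ] // [ [] ⊢ ((A [ a / x ]) ∷ []) ] // [ Γ₂ ⊢ Δ₂ ] // H) →
         LNIF (G // [ Γ₁ ⊢ Δ₁ ] // [ Γ₂ ⊢ (∀' x A ∷ Δ₂) ] // H) →
         LNIF (G // [ Γ₁ ⊢ (∀' x A ∷ Δ₁) ] // [ Γ₂ ⊢ Δ₂ ] // H)

-- Merging two adjacent components commutes with every rule of LNIF, so a merge can be pushed
-- up to the axioms.  The exception is a lift between the two merged components: the merged
-- component then contains the lifted formula twice, so left contraction has to be admissible
-- first.  Contraction is proved by induction on the contracted formula and, inside, on the
-- derivation.  When one copy is principal in a left rule, the other copy is removed by
-- inverting that rule (∧l, ∨l, ∃l and the left premise of ⊃l) and contracting the smaller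
-- formulas this produces.  Inverting ∃l substitutes a given parameter for the eigenvariable, so
-- inversion is proved for derivations under an arbitrary renaming of parameters, renaming
-- each eigenvariable met on the way to a fresh parameter.

module Submission where

open import Defs
open import Data.Empty using (⊥-elim)
open import Data.List using (List; []; _∷_; _++_; [_]; map; replicate; concat; concatMap)
import Data.List.Properties as List
open import Data.List.Extrema.Nat using (max; xs≤max)
open import Data.List.Membership.Propositional using (_∈_; _∉_)
open import Data.List.Membership.Propositional.Properties using (∈-++⁺ˡ; ∈-++⁺ʳ; ∈-++⁻; ∈-∃++)
open import Data.List.Relation.Unary.All as All using (All; []; _∷_)
open import Data.List.Relation.Unary.All.Properties using (replicate⁺)
open import Data.List.Relation.Unary.Any using (here; there)
open import Data.List.Relation.Binary.Pointwise as Pw using (Pointwise; []; _∷_)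
open import Data.List.Relation.Binary.Subset.Propositional using (_⊆_)
import Data.List.Relation.Binary.Subset.Propositional.Properties as ⊆
open import Data.List.Relation.Binary.Permutation.Propositional
  using (_↭_; ↭-refl; ↭-sym; ↭-trans; ↭-reflexive; prep)
open import Data.List.Relation.Binary.Permutation.Propositional.Properties
  using (shift; shifts; drop-∷; ∈-resp-↭; ++⁺ˡ; ++⁺; ++-comm; ++-assoc; map⁺)
open import Data.Bool using (true; false)
open import Data.Nat using (ℕ; zero; suc; _+_; _<_; s≤s; _≡ᵇ_; _≟_)
open import Data.Nat.Properties using (n≮n; ≤-reflexive; m≤m+n; m≤n+m)
open import Data.Product using (Σ; _×_; _,_)
open import Data.Sum as Sum using (_⊎_; inj₁; inj₂)
open import Data.Unit using (⊤; tt)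
open import Function using (_∘_; id)
import Induction.WellFounded as WF
open import Data.Nat.Induction using (<-wellFounded)
import Relation.Binary.Construct.On as On
open import Relation.Nullary using (yes; no)
open import Relation.Binary.PropositionalEquality
  using (_≡_; refl; sym; trans; cong; cong₂; subst; module ≡-Reasoning)

concatMap-++ : ∀ {A B : Set} (f : A → List B) xs ys →
               concatMap f (xs ++ ys) ≡ concatMap f xs ++ concatMap f ys
concatMap-++ f xs ys =
  trans (cong concat (List.map-++ f xs ys)) (sym (List.concat-++ (map f xs) (map f ys)))

∈⇒↭∷ : ∀ {A : Set} {x : A} {xs} → x ∈ xs → Σ (List A) λ ys → xs ↭ x ∷ ys
∈⇒↭∷ {x = x} x∈xs with ys , zs , refl ← ∈-∃++ x∈xs = ys ++ zs , shift x ys zs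

∉-++⁻ : ∀ {A : Set} {a : A} xs {ys} → a ∉ xs ++ ys → a ∉ xs × a ∉ ys
∉-++⁻ xs a∉ = a∉ ∘ ∈-++⁺ˡ , a∉ ∘ ∈-++⁺ʳ xs

∈-replicate : ∀ {A : Set} {x y : A} k → x ∈ replicate k y → x ≡ y
∈-replicate {y = y} k = All.lookup (replicate⁺ {P = _≡ y} k refl)

↭-head : ∀ {A B : Formula} {Γ} → A ≡ B → A ∷ Γ ↭ B ∷ Γ
↭-head eq = ↭-reflexive (cong (_∷ _) eq)

++-interchange : ∀ {A : Set} (as bs cs ds : List A) →
                 (as ++ bs) ++ (cs ++ ds) ↭ (as ++ cs) ++ (bs ++ ds)
++-interchange as bs cs ds =
  ↭-trans (++-assoc as bs (cs ++ ds))
          (↭-trans (++⁺ˡ as (shifts bs cs)) (↭-sym (++-assoc as cs (bs ++ ds))))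

fresh : List Par → Par
fresh as = suc (max 0 as)

fresh-∉ : ∀ as → fresh as ∉ as
fresh-∉ as a∈as = n≮n (max 0 as) (All.lookup (xs≤max 0 as) a∈as)

parsL : List Formula → List Par
parsL = concatMap parsF

parsL-⊆ : ∀ {Γ Γ'} → Γ' ⊆ Γ → parsL Γ' ⊆ parsL Γ
parsL-⊆ = ⊆.concatMap⁺ parsF

parsL-↭ : ∀ {Γ Γ'} → Γ ↭ Γ' → parsL Γ' ⊆ parsL Γ
parsL-↭ p = parsL-⊆ (⊆.⊆-reflexive-↭ (↭-sym p))

parsC-⊆ : ∀ {c c'} → ante c' ⊆ ante c → succ c' ⊆ succ c → parsC c' ⊆ parsC c
parsC-⊆ p q = ⊆.++⁺ (parsL-⊆ p) (parsL-⊆ q)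

parsS-pointwise : ∀ {R : Comp → Comp → Set} → (∀ {c c'} → R c c' → parsC c' ⊆ parsC c) →
                  ∀ {S S'} → Pointwise R S S' → parsS S' ⊆ parsS S
parsS-pointwise h []       = ⊆.⊆-refl
parsS-pointwise h (r ∷ rs) = ⊆.++⁺ (h r) (parsS-pointwise h rs)

Fresh : Par → LNS → Set
Fresh a S = a ∉ parsS S

∉-parsS : ∀ {a} G c H → a ∉ parsS (G ++ c ∷ H) → a ∉ parsS G × a ∉ parsC c × a ∉ parsS H
∉-parsS G c H a∉ rewrite concatMap-++ parsC G (c ∷ H) with a∉G , a∉cH ← ∉-++⁻ (parsS G) a∉
  = a∉G , ∉-++⁻ (parsC c) a∉cH

∉-parsC-ante : ∀ {a} P Γ Δ → a ∉ parsC ((P ∷ Γ) ⊢ Δ) → a ∉ parsF P × a ∉ parsC (Γ ⊢ Δ)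
∉-parsC-ante P Γ Δ a∉ =
  a∉ ∘ ∈-++⁺ˡ ∘ ∈-++⁺ˡ , a∉ ∘ ⊆.++⁺ˡ (parsL Δ) (⊆.xs⊆ys++xs (parsL Γ) (parsF P))

∉-parsC-succ : ∀ {a} P Γ Δ → a ∉ parsC (Γ ⊢ (P ∷ Δ)) → a ∉ parsF P × a ∉ parsC (Γ ⊢ Δ)
∉-parsC-succ P Γ Δ a∉ =
  a∉ ∘ ∈-++⁺ʳ (parsL Γ) ∘ ∈-++⁺ˡ ,
  a∉ ∘ ⊆.++⁺ʳ (parsL Γ) (⊆.xs⊆ys++xs (parsL Δ) (parsF P))

≈C-refl : ∀ {c} → c ≈C c
≈C-refl = ↭-refl , ↭-refl

≈C-sym : ∀ {c c'} → c ≈C c' → c' ≈C c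
≈C-sym (p , q) = ↭-sym p , ↭-sym q

≈C-trans : ∀ {c c' c''} → c ≈C c' → c' ≈C c'' → c ≈C c''
≈C-trans (p , q) (p' , q') = ↭-trans p p' , ↭-trans q q'

≈S-refl : ∀ {S} → S ≈S S
≈S-refl = Pw.refl ≈C-refl

≈S-trans : ∀ {S S' S''} → S ≈S S' → S' ≈S S'' → S ≈S S''
≈S-trans = Pw.transitive ≈C-trans

parsC-≈ : ∀ {c c'} → c ≈C c' → parsC c' ⊆ parsC c
parsC-≈ (p , q) = ⊆.++⁺ (parsL-↭ p) (parsL-↭ q)

Fresh-resp-≈ : ∀ {a S S'} → S ≈S S' → Fresh a S → Fresh a S'
Fresh-resp-≈ e a∉ = a∉ ∘ parsS-pointwise parsC-≈ e

≈-at : ∀ G H {c c'} → c ≈C c' → (G ++ c ∷ H) ≈S (G ++ c' ∷ H)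
≈-at G H e = Pw.++⁺ (≈S-refl {G}) (e ∷ ≈S-refl)

mset-at : ∀ G H {c c'} → c ≈C c' → LNIF (G ++ c ∷ H) → LNIF (G ++ c' ∷ H)
mset-at G H e = mset (≈-at G H e)

mset-at-both : ∀ G H F {c₁ c₁' c₂ c₂'} → c₁ ≈C c₁' → c₂ ≈C c₂' →
               LNIF (G ++ c₁ ∷ H ++ c₂ ∷ F) → LNIF (G ++ c₁' ∷ H ++ c₂' ∷ F)
mset-at-both G H F e₁ e₂ =
  mset (Pw.++⁺ (≈S-refl {G}) (e₁ ∷ Pw.++⁺ (≈S-refl {H}) (e₂ ∷ ≈S-refl)))

mset-at₂ : ∀ G H {c₁ c₁' c₂ c₂'} → c₁ ≈C c₁' → c₂ ≈C c₂' →
           LNIF (G ++ c₁ ∷ c₂ ∷ H) → LNIF (G ++ c₁' ∷ c₂' ∷ H)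
mset-at₂ G H = mset-at-both G [] H

data PointwiseAt (R : Comp → Comp → Set) (G : LNS) (c : Comp) (H : LNS) : LNS → Set where
  at : ∀ {G' c' H'} → Pointwise R G G' → R c c' → Pointwise R H H' →
       PointwiseAt R G c H (G' ++ c' ∷ H')

pointwiseAt : ∀ {R : Comp → Comp → Set} G {c H S'} →
              Pointwise R (G ++ c ∷ H) S' → PointwiseAt R G c H S'
pointwiseAt []      (r ∷ rs) = at [] r rs
pointwiseAt (_ ∷ G) (r ∷ rs) with at pG rc pH ← pointwiseAt G rs = at (r ∷ pG) rc pH

Admissible : (LNS → LNS → Set) → LNS → Set
Admissible R S = ∀ {S'} → R S S' → LNIF S'

-- A rule is local if it changes a single component only by adding the principal formulas of
-- a shape in front of its antecedent and succedent.
Shape : Set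
Shape = List Formula × List Formula

infix 6 _◂_
_◂_ : Shape → Comp → Comp
(P , Q) ◂ c = (P ++ ante c) ⊢ (Q ++ succ c)

LocalRule : (LNS → Set) → List Shape → Shape → Set
LocalRule Side prems concl =
  ∀ G c H → Side (G ++ concl ◂ c ∷ H) → All (λ s → LNIF (G ++ s ◂ c ∷ H)) prems →
  LNIF (G ++ concl ◂ c ∷ H)

Always : LNS → Set
Always _ = ⊤

local-rule-along : ∀ {R : LNS → LNS → Set} {Side prems concl} → LocalRule Side prems concl →
  (∀ {S S'} → R S S' → Side S → Side S') →
  ∀ {G c H G' c' H'} → (∀ s → R (G ++ s ◂ c ∷ H) (G' ++ s ◂ c' ∷ H')) →
  Side (G ++ concl ◂ c ∷ H) → All (λ s → Admissible R (G ++ s ◂ c ∷ H)) prems →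
  LNIF (G' ++ concl ◂ c' ∷ H')
local-rule-along rule stable r side ihs =
  rule _ _ _ (stable (r _) side) (All.map (λ {s} ih → ih (r s)) ihs)

id₁-rule : ∀ p as → LocalRule Always [] (patom p as ∷ [] , patom p as ∷ [])
id₁-rule p as G c H _ [] = id₁ G (ante c) (succ c) H p as

⊥l-rule : LocalRule Always [] (⊥' ∷ [] , [])
⊥l-rule G c H _ [] = ⊥l G (ante c) (succ c) H

∧l-rule : ∀ A B → LocalRule Always ((A ∷ B ∷ [] , []) ∷ []) (A ∧' B ∷ [] , [])
∧l-rule A B G c H _ (d ∷ []) = ∧l {G} {ante c} {succ c} {H} d

∨r-rule : ∀ A B → LocalRule Always (([] , A ∷ B ∷ []) ∷ []) ([] , A ∨' B ∷ [])
∨r-rule A B G c H _ (d ∷ []) = ∨r {G} {ante c} {succ c} {H} d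

∧r-rule : ∀ A B → LocalRule Always (([] , A ∷ []) ∷ ([] , B ∷ []) ∷ []) ([] , A ∧' B ∷ [])
∧r-rule A B G c H _ (d ∷ e ∷ []) = ∧r {G} {ante c} {succ c} {H} d e

∨l-rule : ∀ A B → LocalRule Always ((A ∷ [] , []) ∷ (B ∷ [] , []) ∷ []) (A ∨' B ∷ [] , [])
∨l-rule A B G c H _ (d ∷ e ∷ []) = ∨l {G} {ante c} {succ c} {H} d e

⊃l-rule : ∀ A B →
  LocalRule Always ((B ∷ [] , []) ∷ (A ⊃ B ∷ [] , A ∷ []) ∷ []) (A ⊃ B ∷ [] , [])
⊃l-rule A B G c H _ (d ∷ e ∷ []) = ⊃l {G} {ante c} {succ c} {H} d e

∀l-rule : ∀ x A a → LocalRule Always (((A [ a / x ]) ∷ ∀' x A ∷ [] , []) ∷ []) (∀' x A ∷ [] , [])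
∀l-rule x A a G c H _ (d ∷ []) = ∀l {G} {ante c} {succ c} {H} {x} {A} a d

∃l-rule : ∀ x A a → LocalRule (Fresh a) (((A [ a / x ]) ∷ [] , []) ∷ []) (∃' x A ∷ [] , [])
∃l-rule x A a G c H fr (d ∷ []) = ∃l {G} {ante c} {succ c} {H} {x} {A} a fr d

∃r-rule : ∀ x A a → LocalRule Always (([] , (A [ a / x ]) ∷ ∃' x A ∷ []) ∷ []) ([] , ∃' x A ∷ [])
∃r-rule x A a G c H _ (d ∷ []) = ∃r {G} {ante c} {succ c} {H} {x} {A} a d

RightRule₁ : (LNS → Set) → Comp → Formula → Set
RightRule₁ Side K P = ∀ G Γ Δ → Side (G ++ (Γ ⊢ (P ∷ Δ)) ∷ []) →
  LNIF (G ++ (Γ ⊢ Δ) ∷ K ∷ []) → LNIF (G ++ (Γ ⊢ (P ∷ Δ)) ∷ [])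

RightRule₂ : (LNS → Set) → Comp → Formula → Set
RightRule₂ Side K P = ∀ G Γ₁ Δ₁ Γ₂ Δ₂ H →
  Side (G ++ (Γ₁ ⊢ (P ∷ Δ₁)) ∷ (Γ₂ ⊢ Δ₂) ∷ H) →
  LNIF (G ++ (Γ₁ ⊢ Δ₁) ∷ K ∷ (Γ₂ ⊢ Δ₂) ∷ H) →
  LNIF (G ++ (Γ₁ ⊢ Δ₁) ∷ (Γ₂ ⊢ (P ∷ Δ₂)) ∷ H) →
  LNIF (G ++ (Γ₁ ⊢ (P ∷ Δ₁)) ∷ (Γ₂ ⊢ Δ₂) ∷ H)

⊃r₁-rule : ∀ A B → RightRule₁ Always ((A ∷ []) ⊢ (B ∷ [])) (A ⊃ B)
⊃r₁-rule A B G Γ Δ _ = ⊃r₁ {G} {Γ} {Δ} {A} {B}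

∀r₁-rule : ∀ x A a → RightRule₁ (Fresh a) ([] ⊢ ((A [ a / x ]) ∷ [])) (∀' x A)
∀r₁-rule x A a G Γ Δ = ∀r₁ {G} {Γ} {Δ} {x} {A} a

⊃r₂-rule : ∀ A B → RightRule₂ Always ((A ∷ []) ⊢ (B ∷ [])) (A ⊃ B)
⊃r₂-rule A B G Γ₁ Δ₁ Γ₂ Δ₂ H _ = ⊃r₂ {G} {Γ₁} {Δ₁} {Γ₂} {Δ₂} {H} {A} {B}

∀r₂-rule : ∀ x A a → RightRule₂ (Fresh a) ([] ⊢ ((A [ a / x ]) ∷ [])) (∀' x A)
∀r₂-rule x A a G Γ₁ Δ₁ Γ₂ Δ₂ H = ∀r₂ {G} {Γ₁} {Δ₁} {Γ₂} {Δ₂} {H} {x} {A} a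

lift-rule : ∀ G Γ₁ Δ₁ Γ₂ Δ₂ H A →
  LNIF (G ++ ((A ∷ Γ₁) ⊢ Δ₁) ∷ ((A ∷ Γ₂) ⊢ Δ₂) ∷ H) →
  LNIF (G ++ ((A ∷ Γ₁) ⊢ Δ₁) ∷ (Γ₂ ⊢ Δ₂) ∷ H)
lift-rule G Γ₁ Δ₁ Γ₂ Δ₂ H A = lift {G} {Γ₁} {Δ₁} {Γ₂} {Δ₂} {H} {A}

lift-all : ∀ G L Γ₁ Δ₁ Γ₂ Δ₂ H →
  LNIF (G ++ ((L ++ Γ₁) ⊢ Δ₁) ∷ ((L ++ Γ₂) ⊢ Δ₂) ∷ H) →
  LNIF (G ++ ((L ++ Γ₁) ⊢ Δ₁) ∷ (Γ₂ ⊢ Δ₂) ∷ H)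
lift-all G []      Γ₁ Δ₁ Γ₂ Δ₂ H d = d
lift-all G (A ∷ L) Γ₁ Δ₁ Γ₂ Δ₂ H d =
  mset-at G ((Γ₂ ⊢ Δ₂) ∷ H) (shift A L Γ₁ , ↭-refl)
    (lift-all G L (A ∷ Γ₁) Δ₁ Γ₂ Δ₂ H
      (mset-at G (((L ++ Γ₂) ⊢ Δ₂) ∷ H) (↭-sym (shift A L Γ₁) , ↭-refl)
        (lift-rule G (L ++ Γ₁) Δ₁ (L ++ Γ₂) Δ₂ H A d)))

-- Renaming parameters

renT : (Par → Par) → Term → Term
renT σ (var x) = var x
renT σ (par a) = par (σ a)

renTs : (Par → Par) → List Term → List Term
renTs σ []       = []
renTs σ (t ∷ ts) = renT σ t ∷ renTs σ ts

ren : (Par → Par) → Formula → Formula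
ren σ (atom p ts) = atom p (renTs σ ts)
ren σ ⊥'          = ⊥'
ren σ (A ∧' B)    = ren σ A ∧' ren σ B
ren σ (A ∨' B)    = ren σ A ∨' ren σ B
ren σ (A ⊃ B)     = ren σ A ⊃ ren σ B
ren σ (∀' x A)    = ∀' x (ren σ A)
ren σ (∃' x A)    = ∃' x (ren σ A)

renL : (Par → Par) → List Formula → List Formula
renL σ = map (ren σ)

renTs-subst : ∀ σ a x ts → renTs σ (substTs a x ts) ≡ substTs (σ a) x (renTs σ ts)
renTs-subst σ a x []            = refl
renTs-subst σ a x (par b ∷ ts)  = cong (par (σ b) ∷_) (renTs-subst σ a x ts)
renTs-subst σ a x (var y ∷ ts) with x ≡ᵇ y
... | true  = cong (par (σ a) ∷_) (renTs-subst σ a x ts)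
... | false = cong (var y ∷_) (renTs-subst σ a x ts)

ren-subst : ∀ σ a x A → ren σ (A [ a / x ]) ≡ ren σ A [ σ a / x ]
ren-subst σ a x (atom p ts) = cong (atom p) (renTs-subst σ a x ts)
ren-subst σ a x ⊥'          = refl
ren-subst σ a x (A ∧' B)    = cong₂ _∧'_ (ren-subst σ a x A) (ren-subst σ a x B)
ren-subst σ a x (A ∨' B)    = cong₂ _∨'_ (ren-subst σ a x A) (ren-subst σ a x B)
ren-subst σ a x (A ⊃ B)     = cong₂ _⊃_ (ren-subst σ a x A) (ren-subst σ a x B)
ren-subst σ a x (∀' y A) with x ≡ᵇ y
... | true  = refl
... | false = cong (∀' y) (ren-subst σ a x A)
ren-subst σ a x (∃' y A) with x ≡ᵇ y
... | true  = refl
... | false = cong (∃' y) (ren-subst σ a x A)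

Agree : (Par → Par) → (Par → Par) → List Par → Set
Agree σ τ as = ∀ {a} → a ∈ as → σ a ≡ τ a

renTs-ext : ∀ {σ τ} ts → Agree σ τ (concatMap parsT ts) → renTs σ ts ≡ renTs τ ts
renTs-ext []           h = refl
renTs-ext (var x ∷ ts) h = cong (var x ∷_) (renTs-ext ts h)
renTs-ext (par a ∷ ts) h = cong₂ _∷_ (cong par (h (here refl))) (renTs-ext ts (h ∘ there))

ren-ext : ∀ {σ τ} A → Agree σ τ (parsF A) → ren σ A ≡ ren τ A
ren-ext (atom p ts) h = cong (atom p) (renTs-ext ts h)
ren-ext ⊥'          h = refl
ren-ext (A ∧' B)    h = cong₂ _∧'_ (ren-ext A (h ∘ ∈-++⁺ˡ)) (ren-ext B (h ∘ ∈-++⁺ʳ (parsF A)))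
ren-ext (A ∨' B)    h = cong₂ _∨'_ (ren-ext A (h ∘ ∈-++⁺ˡ)) (ren-ext B (h ∘ ∈-++⁺ʳ (parsF A)))
ren-ext (A ⊃ B)     h = cong₂ _⊃_ (ren-ext A (h ∘ ∈-++⁺ˡ)) (ren-ext B (h ∘ ∈-++⁺ʳ (parsF A)))
ren-ext (∀' x A)    h = cong (∀' x) (ren-ext A h)
ren-ext (∃' x A)    h = cong (∃' x) (ren-ext A h)

renL-ext : ∀ {σ τ} Γ → Agree σ τ (parsL Γ) → renL σ Γ ≡ renL τ Γ
renL-ext []      h = refl
renL-ext (A ∷ Γ) h = cong₂ _∷_ (ren-ext A (h ∘ ∈-++⁺ˡ)) (renL-ext Γ (h ∘ ∈-++⁺ʳ (parsF A)))

renTs-id : ∀ ts → renTs id ts ≡ ts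
renTs-id []           = refl
renTs-id (var x ∷ ts) = cong (var x ∷_) (renTs-id ts)
renTs-id (par a ∷ ts) = cong (par a ∷_) (renTs-id ts)

ren-id : ∀ A → ren id A ≡ A
ren-id (atom p ts) = cong (atom p) (renTs-id ts)
ren-id ⊥'          = refl
ren-id (A ∧' B)    = cong₂ _∧'_ (ren-id A) (ren-id B)
ren-id (A ∨' B)    = cong₂ _∨'_ (ren-id A) (ren-id B)
ren-id (A ⊃ B)     = cong₂ _⊃_ (ren-id A) (ren-id B)
ren-id (∀' x A)    = cong (∀' x) (ren-id A)
ren-id (∃' x A)    = cong (∃' x) (ren-id A)

renL-id : ∀ Γ → renL id Γ ≡ Γ
renL-id []      = refl
renL-id (A ∷ Γ) = cong₂ _∷_ (ren-id A) (renL-id Γ)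

ren-patom : ∀ σ p as → ren σ (patom p as) ≡ patom p (map σ as)
ren-patom σ p as = cong (atom p) (renTs-map as)
  where
  renTs-map : ∀ as → renTs σ (map par as) ≡ map par (map σ as)
  renTs-map []       = refl
  renTs-map (a ∷ as) = cong (par (σ a) ∷_) (renTs-map as)

update : (Par → Par) → Par → Par → Par → Par
update σ a b c with c ≟ a
... | yes _ = b
... | no  _ = σ c

update-same : ∀ σ a b → update σ a b a ≡ b
update-same σ a b with a ≟ a
... | yes _   = refl
... | no  a≢a = ⊥-elim (a≢a refl)

update-agree : ∀ σ {a} b as → a ∉ as → Agree (update σ a b) σ as
update-agree σ {a} b as a∉ {c} c∈ with c ≟ a
... | yes refl = ⊥-elim (a∉ c∈)
... | no  _    = refl

ren-update : ∀ σ {a} b A → a ∉ parsF A → ren (update σ a b) A ≡ ren σ A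
ren-update σ b A a∉ = ren-ext A (update-agree σ b (parsF A) a∉)

renL-update : ∀ σ {a} b Γ → a ∉ parsL Γ → renL (update σ a b) Γ ≡ renL σ Γ
renL-update σ b Γ a∉ = renL-ext Γ (update-agree σ b (parsL Γ) a∉)

ren-update-subst : ∀ σ a b x A → a ∉ parsF A → ren (update σ a b) (A [ a / x ]) ≡ ren σ A [ b / x ]
ren-update-subst σ a b x A a∉ = begin
  ren (update σ a b) (A [ a / x ])            ≡⟨ ren-subst (update σ a b) a x A ⟩
  ren (update σ a b) A [ update σ a b a / x ] ≡⟨ cong₂ (λ B c → B [ c / x ]) (ren-update σ b A a∉)
                                                                          (update-same σ a b) ⟩
  ren σ A [ b / x ]                           ∎
  where open ≡-Reasoning

size : Formula → ℕ
size (atom p ts) = 0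
size ⊥'          = 0
size (A ∧' B)    = suc (size A + size B)
size (A ∨' B)    = suc (size A + size B)
size (A ⊃ B)     = suc (size A + size B)
size (∀' x A)    = suc (size A)
size (∃' x A)    = suc (size A)

size-subst : ∀ A a x → size (A [ a / x ]) ≡ size A
size-subst (atom p ts) a x = refl
size-subst ⊥'          a x = refl
size-subst (A ∧' B)    a x = cong₂ (λ m n → suc (m + n)) (size-subst A a x) (size-subst B a x)
size-subst (A ∨' B)    a x = cong₂ (λ m n → suc (m + n)) (size-subst A a x) (size-subst B a x)
size-subst (A ⊃ B)     a x = cong₂ (λ m n → suc (m + n)) (size-subst A a x) (size-subst B a x)
size-subst (∀' y A)    a x with x ≡ᵇ y
... | true  = refl
... | false = cong suc (size-subst A a x)
size-subst (∃' y A)    a x with x ≡ᵇ y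
... | true  = refl
... | false = cong suc (size-subst A a x)

-- Inversion of the left rules

Replaces : Formula → List Formula → List Formula → List Formula → Set
Replaces F L Γ Γ' = Σ ℕ λ k → Σ (List Formula) λ Γ₀ →
  (Γ ↭ replicate k F ++ Γ₀) × (Γ' ↭ concat (replicate k L) ++ Γ₀)

module _ {F : Formula} {L : List Formula} where

  replaces-refl : ∀ {Γ} → Replaces F L Γ Γ
  replaces-refl {Γ} = 0 , Γ , ↭-refl , ↭-refl

  replaces-∷ : ∀ {x Γ Γ'} → Replaces F L Γ Γ' → Replaces F L (x ∷ Γ) (x ∷ Γ')
  replaces-∷ {x} (k , Γ₀ , p , q) =
    k , x ∷ Γ₀ , ↭-trans (prep x p) (↭-sym (shift x (replicate k F) Γ₀)) ,
                 ↭-trans (prep x q) (↭-sym (shift x (concat (replicate k L)) Γ₀))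

  replaces-respˡ : ∀ {Γ₀ Γ Γ'} → Γ₀ ↭ Γ → Replaces F L Γ Γ' → Replaces F L Γ₀ Γ'
  replaces-respˡ e (k , Γ₀ , p , q) = k , Γ₀ , ↭-trans e p , q

  replaces-add : ∀ {Γ Γ'} → Replaces F L Γ Γ' → Replaces F L (F ∷ Γ) (L ++ Γ')
  replaces-add (k , Γ₀ , p , q) =
    suc k , Γ₀ , prep F p , ↭-trans (++⁺ˡ L q) (↭-sym (++-assoc L (concat (replicate k L)) Γ₀))

  data ReplacesView : Formula → List Formula → List Formula → Set where
    replaced : ∀ {Γ Γ'} Γ'' → Replaces F L Γ Γ'' → Γ' ↭ L ++ Γ'' → ReplacesView F Γ Γ'
    kept     : ∀ {P Γ Γ'} Γ'' → Replaces F L Γ Γ'' → Γ' ↭ P ∷ Γ'' → ReplacesView P Γ Γ'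

  replaces-view : ∀ {P Γ Γ'} → Replaces F L (P ∷ Γ) Γ' → ReplacesView P Γ Γ'
  replaces-view {Γ = Γ} (zero , Γ₀ , p , q) = kept Γ replaces-refl (↭-trans q (↭-sym p))
  replaces-view (suc k , Γ₀ , p , q) with ∈-resp-↭ p (here refl)
  ... | here refl = replaced _ (k , Γ₀ , drop-∷ p , ↭-refl) (↭-trans q (++-assoc L _ Γ₀))
  ... | there P∈ with ∈-++⁻ (replicate k F) P∈
  ...   | inj₁ P∈Fs with refl ← ∈-replicate k P∈Fs =
    replaced _ (k , Γ₀ , drop-∷ p , ↭-refl) (↭-trans q (++-assoc L _ Γ₀))
  ...   | inj₂ P∈Γ₀ with Γ₁ , e ← ∈⇒↭∷ P∈Γ₀ =
    kept (Ls ++ Γ₁)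
         (suc k , Γ₁ , drop-∷ (↭-trans p (↭-trans (++⁺ˡ Fs e) (shift _ Fs Γ₁))) , ↭-refl)
         (↭-trans q (↭-trans (++⁺ˡ Ls e) (shift _ Ls Γ₁)))
    where
    Fs Ls : List Formula
    Fs = replicate (suc k) F
    Ls = concat (replicate (suc k) L)

data LeftInversion : Formula → List Formula → Set where
  ∧-inv  : ∀ A B → LeftInversion (A ∧' B) (A ∷ B ∷ [])
  ∨-inv₁ : ∀ A B → LeftInversion (A ∨' B) (A ∷ [])
  ∨-inv₂ : ∀ A B → LeftInversion (A ∨' B) (B ∷ [])
  ⊃-inv  : ∀ A B → LeftInversion (A ⊃ B) (B ∷ [])
  ∃-inv  : ∀ x A b → LeftInversion (∃' x A) ((A [ b / x ]) ∷ [])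

LeftInversion-smaller : ∀ {F L} → LeftInversion F L → All (λ D → size D < size F) L
LeftInversion-smaller (∧-inv A B)   = s≤s (m≤m+n (size A) (size B)) ∷ s≤s (m≤n+m (size B) (size A)) ∷ []
LeftInversion-smaller (∨-inv₁ A B)  = s≤s (m≤m+n (size A) (size B)) ∷ []
LeftInversion-smaller (∨-inv₂ A B)  = s≤s (m≤n+m (size B) (size A)) ∷ []
LeftInversion-smaller (⊃-inv A B)   = s≤s (m≤n+m (size B) (size A)) ∷ []
LeftInversion-smaller (∃-inv x A b) = s≤s (≤-reflexive (size-subst A b x)) ∷ []

Inverted : (Par → Par) → Formula → List Formula → Comp → Comp → Set
Inverted σ F L c c' = Replaces F L (renL σ (ante c)) (ante c') × (renL σ (succ c) ↭ succ c')

Inverted-respˡ : ∀ {σ F L c₀ c c'} → c₀ ≈C c → Inverted σ F L c c' → Inverted σ F L c₀ c'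
Inverted-respˡ {σ} (p , q) (r , q') = replaces-respˡ (map⁺ (ren σ) p) r , ↭-trans (map⁺ (ren σ) q) q'

Inverted-id : ∀ {F L S} → Pointwise (Inverted id F L) S S
Inverted-id = Pw.refl (replaces-respˡ (↭-reflexive (renL-id _)) replaces-refl , ↭-reflexive (renL-id _))

Inverted-update : ∀ {σ F L a c c'} b → a ∉ parsC c →
                  Inverted σ F L c c' → Inverted (update σ a b) F L c c'
Inverted-update {σ} {F} {L} {c = Γ ⊢ Δ} {c'} b a∉ (r , q) with a∉Γ , a∉Δ ← ∉-++⁻ (parsL Γ) a∉ =
  subst (λ Γ → Replaces F L Γ (ante c')) (sym (renL-update σ b Γ a∉Γ)) r ,
  subst (_↭ succ c') (sym (renL-update σ b Δ a∉Δ)) q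

Inverted-updates : ∀ {σ F L a S S'} b → Fresh a S → Pointwise (Inverted σ F L) S S' →
                   Pointwise (Inverted (update σ a b) F L) S S'
Inverted-updates b a∉ [] = []
Inverted-updates {S = c ∷ S} b a∉ (r ∷ rs) with a∉c , a∉S ← ∉-++⁻ (parsC c) a∉ =
  Inverted-update b a∉c r ∷ Inverted-updates b a∉S rs

Inverted-∃l-premise : ∀ {F L} σ {a} b {G Γ Δ H x A G' Γ'' Δ' H'} →
  Fresh a (G ++ ((∃' x A ∷ Γ) ⊢ Δ) ∷ H) →
  Pointwise (Inverted σ F L) G G' → Replaces F L (renL σ Γ) Γ'' → renL σ Δ ↭ Δ' →
  Pointwise (Inverted σ F L) H H' →
  Pointwise (Inverted (update σ a b) F L)
    (G ++ (((A [ a / x ]) ∷ Γ) ⊢ Δ) ∷ H) (G' ++ (((ren σ A [ b / x ]) ∷ Γ'') ⊢ Δ') ∷ H')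
Inverted-∃l-premise σ {a} b {G} {Γ} {Δ} {H} {x} {A} fr pG r rs pH
  with a∉G , a∉c , a∉H ← ∉-parsS G _ H fr
  with a∉A , a∉ΓΔ ← ∉-parsC-ante (∃' x A) Γ Δ a∉c
  with r' , rs' ← Inverted-update b a∉ΓΔ (r , rs)
  = Pw.++⁺ (Inverted-updates b a∉G pG)
      ((replaces-respˡ (↭-head (ren-update-subst σ a b x A a∉A)) (replaces-∷ r') , rs') ∷
       Inverted-updates b a∉H pH)

-- The eigenvariable is renamed to the parameter of the inversion if the inverted occurrence
-- is principal, and to a fresh parameter otherwise.
invert-∃l : ∀ {F L} → LeftInversion F L → ∀ σ {G Γ Δ H x A} a →
  Fresh a (G ++ ((∃' x A ∷ Γ) ⊢ Δ) ∷ H) →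
  (∀ b → Admissible (Pointwise (Inverted (update σ a b) F L)) (G ++ (((A [ a / x ]) ∷ Γ) ⊢ Δ) ∷ H)) →
  Admissible (Pointwise (Inverted σ F L)) (G ++ ((∃' x A ∷ Γ) ⊢ Δ) ∷ H)
invert-∃l s σ {G} {Γ} {Δ} {H} {x} {A} a fr ih rel
  with at {G'} {c'} {H'} pG (ra , rs) pH ← pointwiseAt G rel
  with replaces-view ra
... | kept Γ'' r q =
  mset-at G' H' (↭-sym q , ↭-refl)
    (∃l-rule x (ren σ A) a' G' (Γ'' ⊢ succ c') H' a'-fresh
      (ih a' (Inverted-∃l-premise σ a' fr pG r rs pH) ∷ []))
  where
  a' : Par
  a' = fresh (parsS (G' ++ c' ∷ H'))
  a'-fresh : Fresh a' (G' ++ ((∃' x (ren σ A) ∷ Γ'') ⊢ succ c') ∷ H')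
  a'-fresh = Fresh-resp-≈ (≈-at G' H' (q , ↭-refl)) (fresh-∉ (parsS (G' ++ c' ∷ H')))
... | replaced Γ'' r q with s
...   | ∃-inv _ _ b = mset-at G' H' (↭-sym q , ↭-refl) (ih b (Inverted-∃l-premise σ b fr pG r rs pH))

invert-∀r₁ : ∀ {F L} σ {G Γ Δ x A} a → Fresh a (G ++ (Γ ⊢ (∀' x A ∷ Δ)) ∷ []) →
  (∀ b → Admissible (Pointwise (Inverted (update σ a b) F L))
                    (G ++ (Γ ⊢ Δ) ∷ ([] ⊢ ((A [ a / x ]) ∷ [])) ∷ [])) →
  Admissible (Pointwise (Inverted σ F L)) (G ++ (Γ ⊢ (∀' x A ∷ Δ)) ∷ [])
invert-∀r₁ σ {G} {Γ} {Δ} {x} {A} a fr ih rel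
  with a∉G , a∉c , _ ← ∉-parsS G _ [] fr
  with a∉A , a∉ΓΔ ← ∉-parsC-succ (∀' x A) Γ Δ a∉c
  with at {G'} {c'} pG (ra , rs) [] ← pointwiseAt G rel
  = mset-at G' [] (↭-refl , rs)
      (∀r₁-rule x (ren σ A) a' G' (ante c') (renL σ Δ) a'-fresh
        (ih a' (Pw.++⁺ (Inverted-updates a' a∉G pG)
                  (Inverted-update a' a∉ΓΔ (ra , ↭-refl) ∷
                   (replaces-refl , ↭-head (ren-update-subst σ a a' x A a∉A)) ∷ []))))
  where
  a' : Par
  a' = fresh (parsS (G' ++ c' ∷ []))
  a'-fresh : Fresh a' (G' ++ (ante c' ⊢ (∀' x (ren σ A) ∷ renL σ Δ)) ∷ [])
  a'-fresh = Fresh-resp-≈ (≈-at G' [] (↭-refl , ↭-sym rs)) (fresh-∉ (parsS (G' ++ c' ∷ [])))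

invert-∀r₂ : ∀ {F L} σ {G Γ₁ Δ₁ Γ₂ Δ₂ H x A} a →
  Fresh a (G ++ (Γ₁ ⊢ (∀' x A ∷ Δ₁)) ∷ (Γ₂ ⊢ Δ₂) ∷ H) →
  (∀ b → Admissible (Pointwise (Inverted (update σ a b) F L))
                    (G ++ (Γ₁ ⊢ Δ₁) ∷ ([] ⊢ ((A [ a / x ]) ∷ [])) ∷ (Γ₂ ⊢ Δ₂) ∷ H)) →
  Admissible (Pointwise (Inverted σ F L)) (G ++ (Γ₁ ⊢ Δ₁) ∷ (Γ₂ ⊢ (∀' x A ∷ Δ₂)) ∷ H) →
  Admissible (Pointwise (Inverted σ F L)) (G ++ (Γ₁ ⊢ (∀' x A ∷ Δ₁)) ∷ (Γ₂ ⊢ Δ₂) ∷ H)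
invert-∀r₂ σ {G} {Γ₁} {Δ₁} {x = x} {A} a fr ih-d ih-e rel
  with a∉G , a∉c , a∉c₂H ← ∉-parsS G _ _ fr
  with a∉A , a∉ΓΔ ← ∉-parsC-succ (∀' x A) Γ₁ Δ₁ a∉c
  with at {G'} {c₁'} {c₂' ∷ H'} pG (ra , rs) ((ra₂ , rs₂) ∷ pH) ← pointwiseAt G rel
  = mset-at G' (c₂' ∷ H') (↭-refl , rs)
      (∀r₂-rule x (ren σ A) a' G' (ante c₁') (renL σ Δ₁) (ante c₂') (succ c₂') H' a'-fresh
        (ih-d a' (Pw.++⁺ (Inverted-updates a' a∉G pG)
                    (Inverted-update a' a∉ΓΔ (ra , ↭-refl) ∷
                     (replaces-refl , ↭-head (ren-update-subst σ a a' x A a∉A)) ∷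
                     Inverted-updates a' a∉c₂H ((ra₂ , rs₂) ∷ pH))))
        (ih-e (Pw.++⁺ pG ((ra , ↭-refl) ∷ (ra₂ , prep _ rs₂) ∷ pH))))
  where
  a' : Par
  a' = fresh (parsS (G' ++ c₁' ∷ c₂' ∷ H'))
  a'-fresh : Fresh a' (G' ++ (ante c₁' ⊢ (∀' x (ren σ A) ∷ renL σ Δ₁)) ∷ c₂' ∷ H')
  a'-fresh =
    Fresh-resp-≈ (≈-at G' (c₂' ∷ H') (↭-refl , ↭-sym rs)) (fresh-∉ (parsS (G' ++ c₁' ∷ c₂' ∷ H')))

invert : ∀ {F L} → LeftInversion F L → ∀ σ {S} → LNIF S → Admissible (Pointwise (Inverted σ F L)) S
invert s σ (mset e d) rel = invert s σ d (Pw.transitive Inverted-respˡ e rel)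
invert s σ (id₁ G Γ Δ H p as) rel
  with at {G'} {c'} {H'} pG (ra , rs) pH ← pointwiseAt G rel | replaces-view ra
... | kept Γ'' _ q =
  mset-at G' H' (↭-trans (↭-head (sym (ren-patom σ p as))) (↭-sym q) ,
                 ↭-trans (↭-head (sym (ren-patom σ p as))) rs)
    (id₁ G' Γ'' (renL σ Δ) H' p (map σ as))
... | replaced _ _ _ with () ← s
invert s σ (id₂ G Γ₁ Δ₁ H Γ₂ Δ₂ Fs p as) rel
  with at {G'} {c₁'} pG (ra₁ , rs₁) rest ← pointwiseAt G rel
  with at {H'} {c₂'} {Fs'} pH (ra₂ , rs₂) pF ← pointwiseAt H rest
  with replaces-view ra₁
... | kept Γ'' _ q =
  mset-at-both G' H' Fs' (↭-trans (↭-head (sym (ren-patom σ p as))) (↭-sym q) , ↭-refl)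
                         (↭-refl , ↭-trans (↭-head (sym (ren-patom σ p as))) rs₂)
    (id₂ G' Γ'' (succ c₁') H' (ante c₂') (renL σ Δ₂) Fs' p (map σ as))
... | replaced _ _ _ with () ← s
invert s σ (⊥l G Γ Δ H) rel
  with at {G'} {c'} {H'} pG (ra , rs) pH ← pointwiseAt G rel | replaces-view ra
... | kept Γ'' _ q = mset-at G' H' (↭-sym q , rs) (⊥l G' Γ'' (renL σ Δ) H')
... | replaced _ _ _ with () ← s
invert s σ (∧l {G} {Γ} {Δ} {H} {A} {B} d) rel
  with at {G'} {c'} {H'} pG (ra , rs) pH ← pointwiseAt G rel | replaces-view ra
... | kept Γ'' r q =
  mset-at G' H' (↭-sym q , rs)
    (∧l-rule (ren σ A) (ren σ B) G' (Γ'' ⊢ renL σ Δ) H' tt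
      (invert s σ d (Pw.++⁺ pG ((replaces-∷ (replaces-∷ r) , ↭-refl) ∷ pH)) ∷ []))
... | replaced Γ'' r q with ∧-inv _ _ ← s =
  mset-at G' H' (↭-sym q , rs) (invert s σ d (Pw.++⁺ pG ((replaces-∷ (replaces-∷ r) , ↭-refl) ∷ pH)))
invert s σ (∨r {G} {Γ} {Δ} {H} {A} {B} d) rel with at {G'} {c'} {H'} pG (ra , rs) pH ← pointwiseAt G rel =
  mset-at G' H' (↭-refl , rs)
    (∨r-rule (ren σ A) (ren σ B) G' (ante c' ⊢ renL σ Δ) H' tt
      (invert s σ d (Pw.++⁺ pG ((ra , ↭-refl) ∷ pH)) ∷ []))
invert s σ (∧r {G} {Γ} {Δ} {H} {A} {B} d e) rel with at {G'} {c'} {H'} pG (ra , rs) pH ← pointwiseAt G rel =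
  mset-at G' H' (↭-refl , rs)
    (∧r-rule (ren σ A) (ren σ B) G' (ante c' ⊢ renL σ Δ) H' tt
      (invert s σ d (Pw.++⁺ pG ((ra , ↭-refl) ∷ pH)) ∷
       invert s σ e (Pw.++⁺ pG ((ra , ↭-refl) ∷ pH)) ∷ []))
invert s σ (∨l {G} {Γ} {Δ} {H} {A} {B} d e) rel
  with at {G'} {c'} {H'} pG (ra , rs) pH ← pointwiseAt G rel | replaces-view ra
... | kept Γ'' r q =
  mset-at G' H' (↭-sym q , rs)
    (∨l-rule (ren σ A) (ren σ B) G' (Γ'' ⊢ renL σ Δ) H' tt
      (invert s σ d (Pw.++⁺ pG ((replaces-∷ r , ↭-refl) ∷ pH)) ∷
       invert s σ e (Pw.++⁺ pG ((replaces-∷ r , ↭-refl) ∷ pH)) ∷ []))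
... | replaced Γ'' r q with s
...   | ∨-inv₁ _ _ =
  mset-at G' H' (↭-sym q , rs) (invert s σ d (Pw.++⁺ pG ((replaces-∷ r , ↭-refl) ∷ pH)))
...   | ∨-inv₂ _ _ =
  mset-at G' H' (↭-sym q , rs) (invert s σ e (Pw.++⁺ pG ((replaces-∷ r , ↭-refl) ∷ pH)))
invert s σ (⊃r₁ {G} {Γ} {Δ} {A} {B} d) rel with at {G'} {c'} pG (ra , rs) [] ← pointwiseAt G rel =
  mset-at G' [] (↭-refl , rs)
    (⊃r₁-rule (ren σ A) (ren σ B) G' (ante c') (renL σ Δ) tt
      (invert s σ d (Pw.++⁺ pG ((ra , ↭-refl) ∷ (replaces-refl , ↭-refl) ∷ []))))
invert s σ (⊃l {G} {Γ} {Δ} {H} {A} {B} d e) rel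
  with at {G'} {c'} {H'} pG (ra , rs) pH ← pointwiseAt G rel | replaces-view ra
... | kept Γ'' r q =
  mset-at G' H' (↭-sym q , rs)
    (⊃l-rule (ren σ A) (ren σ B) G' (Γ'' ⊢ renL σ Δ) H' tt
      (invert s σ d (Pw.++⁺ pG ((replaces-∷ r , ↭-refl) ∷ pH)) ∷
       invert s σ e (Pw.++⁺ pG ((replaces-∷ r , ↭-refl) ∷ pH)) ∷ []))
... | replaced Γ'' r q with ⊃-inv _ _ ← s =
  mset-at G' H' (↭-sym q , rs) (invert s σ d (Pw.++⁺ pG ((replaces-∷ r , ↭-refl) ∷ pH)))
invert s σ (lift {G} {Γ₁} {Δ₁} {Γ₂} {Δ₂} {H} {A} d) rel
  with at {G'} {c₁'} {c₂' ∷ H'} pG (ra₁ , rs₁) ((ra₂ , rs₂) ∷ pH) ← pointwiseAt G rel | replaces-view ra₁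
... | kept Γ'' r q =
  mset-at G' (c₂' ∷ H') (↭-sym q , ↭-refl)
    (lift-rule G' Γ'' (succ c₁') (ante c₂') (succ c₂') H' (ren σ A)
      (invert s σ d (Pw.++⁺ pG ((replaces-∷ r , rs₁) ∷ (replaces-∷ ra₂ , rs₂) ∷ pH))))
... | replaced Γ'' r q =
  mset-at G' (c₂' ∷ H') (↭-sym q , ↭-refl)
    (lift-all G' _ Γ'' (succ c₁') (ante c₂') (succ c₂') H'
      (invert s σ d (Pw.++⁺ pG ((replaces-add r , rs₁) ∷ (replaces-add ra₂ , rs₂) ∷ pH))))
invert s σ (∀l {G} {Γ} {Δ} {H} {x} {A} a d) rel
  with at {G'} {c'} {H'} pG (ra , rs) pH ← pointwiseAt G rel | replaces-view ra
... | kept Γ'' r q =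
  mset-at G' H' (↭-sym q , rs)
    (∀l-rule x (ren σ A) (σ a) G' (Γ'' ⊢ renL σ Δ) H' tt
      (invert s σ d (Pw.++⁺ pG
        ((replaces-respˡ (↭-head (ren-subst σ a x A)) (replaces-∷ (replaces-∷ r)) , ↭-refl) ∷ pH)) ∷ []))
... | replaced _ _ _ with () ← s
invert s σ (∃r {G} {Γ} {Δ} {H} {x} {A} a d) rel with at {G'} {c'} {H'} pG (ra , rs) pH ← pointwiseAt G rel =
  mset-at G' H' (↭-refl , rs)
    (∃r-rule x (ren σ A) (σ a) G' (ante c' ⊢ renL σ Δ) H' tt
      (invert s σ d (Pw.++⁺ pG ((ra , ↭-head (ren-subst σ a x A)) ∷ pH)) ∷ []))
invert s σ (∃l a fr d) = invert-∃l s σ a fr (λ b → invert s (update σ a b) d)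
invert s σ (∀r₁ a fr d) = invert-∀r₁ σ a fr (λ b → invert s (update σ a b) d)
invert s σ (∀r₂ a fr d e) = invert-∀r₂ σ a fr (λ b → invert s (update σ a b) d) (invert s σ e)
invert s σ (⊃r₂ {G} {Γ₁} {Δ₁} {Γ₂} {Δ₂} {H} {A} {B} d e) rel
  with at {G'} {c₁'} {c₂' ∷ H'} pG (ra₁ , rs₁) ((ra₂ , rs₂) ∷ pH) ← pointwiseAt G rel =
  mset-at G' (c₂' ∷ H') (↭-refl , rs₁)
    (⊃r₂-rule (ren σ A) (ren σ B) G' (ante c₁') (renL σ Δ₁) (ante c₂') (succ c₂') H' tt
      (invert s σ d (Pw.++⁺ pG ((ra₁ , ↭-refl) ∷ (replaces-refl , ↭-refl) ∷ (ra₂ , rs₂) ∷ pH)))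
      (invert s σ e (Pw.++⁺ pG ((ra₁ , ↭-refl) ∷ (ra₂ , prep _ rs₂) ∷ pH))))

invert-left : ∀ {F L} → LeftInversion F L → ∀ G H Γ Δ →
  LNIF (G ++ ((F ∷ Γ) ⊢ Δ) ∷ H) → LNIF (G ++ ((L ++ Γ) ⊢ Δ) ∷ H)
invert-left {F} s G H Γ Δ d =
  invert s id d (Pw.++⁺ (Inverted-id {S = G})
    ((replaces-respˡ (↭-reflexive (renL-id (F ∷ Γ))) (replaces-add replaces-refl) , ↭-reflexive (renL-id Δ)) ∷
     Inverted-id))

-- Contraction

-- Some copies of A are removed, but never the last one.
ContractsTo : Formula → List Formula → List Formula → Set
ContractsTo A Γ Γ' = Σ ℕ λ k → Σ (List Formula) λ Γ₀ →
  (Γ ↭ replicate k A ++ Γ₀) × (Γ' ↭ Γ₀) × (k ≡ 0 ⊎ A ∈ Γ₀)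

module _ {A : Formula} where

  contracts-refl : ∀ {Γ} → ContractsTo A Γ Γ
  contracts-refl {Γ} = 0 , Γ , ↭-refl , ↭-refl , inj₁ refl

  contracts-∷ : ∀ {x Γ Γ'} → ContractsTo A Γ Γ' → ContractsTo A (x ∷ Γ) (x ∷ Γ')
  contracts-∷ {x} (k , Γ₀ , p , q , k≡0⊎A∈) =
    k , x ∷ Γ₀ , ↭-trans (prep x p) (↭-sym (shift x (replicate k A) Γ₀)) , prep x q ,
    Sum.map id there k≡0⊎A∈

  contracts-respˡ : ∀ {Γ₀ Γ Γ'} → Γ₀ ↭ Γ → ContractsTo A Γ Γ' → ContractsTo A Γ₀ Γ'
  contracts-respˡ e (k , Γ₀ , p , q , k≡0⊎A∈) = k , Γ₀ , ↭-trans e p , q , k≡0⊎A∈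

  contracts-respʳ : ∀ {Γ Γ' Γ''} → ContractsTo A Γ Γ' → Γ' ↭ Γ'' → ContractsTo A Γ Γ''
  contracts-respʳ (k , Γ₀ , p , q , k≡0⊎A∈) e = k , Γ₀ , p , ↭-trans (↭-sym e) q , k≡0⊎A∈

  contracts-copy : ∀ {Γ} → A ∈ Γ → ContractsTo A (A ∷ Γ) Γ
  contracts-copy {Γ} A∈ = 1 , Γ , ↭-refl , ↭-refl , inj₂ A∈

  contracts-⊆ : ∀ {Γ Γ'} → ContractsTo A Γ Γ' → Γ' ⊆ Γ
  contracts-⊆ (k , Γ₀ , p , q , _) =
    ⊆.⊆-trans (⊆.⊆-reflexive-↭ q)
              (⊆.⊆-trans (⊆.xs⊆ys++xs Γ₀ (replicate k A)) (⊆.⊆-reflexive-↭ (↭-sym p)))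

  data ContractsView : Formula → List Formula → List Formula → Set where
    contracted : ∀ {Γ Γ'} Γ'' → ContractsTo A Γ (A ∷ Γ'') → Γ' ↭ A ∷ Γ'' → ContractsView A Γ Γ'
    kept       : ∀ {P Γ Γ'} Γ'' → ContractsTo A Γ Γ'' → Γ' ↭ P ∷ Γ'' → ContractsView P Γ Γ'

  view-contracted : ∀ {k Γ Γ₀ Γ'} → Γ ↭ replicate k A ++ Γ₀ → Γ' ↭ Γ₀ → A ∈ Γ₀ →
                    ContractsView A Γ Γ'
  view-contracted {k} {Γ₀ = Γ₀} p q A∈ with Γ'' , e ← ∈⇒↭∷ A∈ =
    contracted Γ'' (contracts-respʳ (k , Γ₀ , p , ↭-refl , inj₂ A∈) e) (↭-trans q e)

  contracts-view : ∀ {P Γ Γ'} → ContractsTo A (P ∷ Γ) Γ' → ContractsView P Γ Γ'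
  contracts-view {Γ = Γ} (zero , Γ₀ , p , q , _) = kept Γ contracts-refl (↭-trans q (↭-sym p))
  contracts-view (suc k , Γ₀ , p , q , inj₂ A∈Γ₀) with ∈-resp-↭ p (here refl)
  ... | here refl = view-contracted (drop-∷ p) q A∈Γ₀
  ... | there P∈ with ∈-++⁻ (replicate k A) P∈
  ...   | inj₁ P∈As with refl ← ∈-replicate k P∈As = view-contracted (drop-∷ p) q A∈Γ₀
  ...   | inj₂ P∈Γ₀ with Γ₁ , e ← ∈⇒↭∷ P∈Γ₀ with ∈-resp-↭ e A∈Γ₀
  ...     | here refl = view-contracted (drop-∷ p) q A∈Γ₀
  ...     | there A∈Γ₁ =
    kept Γ₁ (suc k , Γ₁ , drop-∷ (↭-trans p (↭-trans (++⁺ˡ As e) (shift _ As Γ₁))) ,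
             ↭-refl , inj₂ A∈Γ₁)
         (↭-trans q e)
    where
    As : List Formula
    As = replicate (suc k) A

  contracts-∈ : ∀ {P Γ Γ'} → ContractsTo A (P ∷ Γ) Γ' → P ∈ Γ'
  contracts-∈ r with contracts-view r
  ... | contracted _ _ q = ∈-resp-↭ (↭-sym q) (here refl)
  ... | kept _ _ q       = ∈-resp-↭ (↭-sym q) (here refl)

Contracted : Formula → Comp → Comp → Set
Contracted A c c' = ContractsTo A (ante c) (ante c') × (succ c ↭ succ c')

Contracted-respˡ : ∀ {A c₀ c c'} → c₀ ≈C c → Contracted A c c' → Contracted A c₀ c'
Contracted-respˡ (p , q) (r , q') = contracts-respˡ p r , ↭-trans q q'

Contracted-refl : ∀ {A S} → Pointwise (Contracted A) S S
Contracted-refl = Pw.refl (contracts-refl , ↭-refl)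

Fresh-Contracted : ∀ {A a S S'} → Pointwise (Contracted A) S S' → Fresh a S → Fresh a S'
Fresh-Contracted rel a∉ =
  a∉ ∘ parsS-pointwise (λ (r , q) → parsC-⊆ (contracts-⊆ r) (⊆.⊆-reflexive-↭ (↭-sym q))) rel

Contractible : Formula → Set
Contractible A = ∀ {S} → LNIF S → Admissible (Pointwise (Contracted A)) S

drop-copy : ∀ {B} → Contractible B → ∀ G H {Γ Δ} → B ∈ Γ →
            LNIF (G ++ ((B ∷ Γ) ⊢ Δ) ∷ H) → LNIF (G ++ (Γ ⊢ Δ) ∷ H)
drop-copy contract-B G H B∈ d =
  contract-B d (Pw.++⁺ (Contracted-refl {S = G}) ((contracts-copy B∈ , ↭-refl) ∷ Contracted-refl))

drop-copies : ∀ {L} → All Contractible L → ∀ G H Γ Δ →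
              LNIF (G ++ ((L ++ L ++ Γ) ⊢ Δ) ∷ H) → LNIF (G ++ ((L ++ Γ) ⊢ Δ) ∷ H)
drop-copies []                    G H Γ Δ d = d
drop-copies {D ∷ L} (contract-D ∷ cs) G H Γ Δ d =
  mset-at G H (shift D L Γ , ↭-refl)
    (drop-copies cs G H (D ∷ Γ) Δ
      (mset-at G H (++⁺ˡ L (↭-sym (shift D L Γ)) , ↭-refl)
        (drop-copy contract-D G H (∈-++⁺ʳ L (here refl)) d)))

drop-inverted : ∀ {F L} → LeftInversion F L → (∀ {D} → size D < size F → Contractible D) →
  ∀ G H Γ Δ → LNIF (G ++ ((L ++ F ∷ Γ) ⊢ Δ) ∷ H) → LNIF (G ++ ((L ++ Γ) ⊢ Δ) ∷ H)
drop-inverted {F} {L} s ih G H Γ Δ d =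
  drop-copies (All.map ih (LeftInversion-smaller s)) G H Γ Δ
    (invert-left s G H (L ++ Γ) Δ (mset-at G H (shift F L Γ , ↭-refl) d))

contract-step : ∀ A → (∀ {B} → size B < size A → Contractible B) → Contractible A
contract-step A ih (mset e d) rel = contract-step A ih d (Pw.transitive Contracted-respˡ e rel)
contract-step A ih (id₁ G Γ Δ H p as) rel
  with at {G'} {c'} {H'} pG (ra , rs) pH ← pointwiseAt G rel
  with Γ₃ , g ← ∈⇒↭∷ (contracts-∈ ra)
  with Δ₃ , h ← ∈⇒↭∷ (∈-resp-↭ rs (here refl))
  = mset-at G' H' (↭-sym g , ↭-sym h) (id₁ G' Γ₃ Δ₃ H' p as)
contract-step A ih (id₂ G Γ₁ Δ₁ H Γ₂ Δ₂ Fs p as) rel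
  with at {G'} {c₁'} pG (ra₁ , rs₁) rest ← pointwiseAt G rel
  with at {H'} {c₂'} {Fs'} pH (ra₂ , rs₂) pF ← pointwiseAt H rest
  with Γ₃ , g ← ∈⇒↭∷ (contracts-∈ ra₁)
  with Δ₃ , h ← ∈⇒↭∷ (∈-resp-↭ rs₂ (here refl))
  = mset-at-both G' H' Fs' (↭-sym g , ↭-refl) (↭-refl , ↭-sym h)
      (id₂ G' Γ₃ (succ c₁') H' (ante c₂') Δ₃ Fs' p as)
contract-step A ih (⊥l G Γ Δ H) rel
  with at {G'} {c'} {H'} pG (ra , rs) pH ← pointwiseAt G rel
  with Γ₃ , g ← ∈⇒↭∷ (contracts-∈ ra)
  = mset-at G' H' (↭-sym g , ↭-refl) (⊥l G' Γ₃ (succ c') H')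
contract-step A ih (∧l {G} {Γ} {Δ} {H} {B} {C} d) rel
  with at {G'} {c'} {H'} pG (ra , rs) pH ← pointwiseAt G rel | contracts-view ra
... | kept Γ'' r q =
  mset-at G' H' (↭-sym q , ↭-refl)
    (∧l-rule B C G' (Γ'' ⊢ succ c') H' tt
      (contract-step A ih d (Pw.++⁺ pG ((contracts-∷ (contracts-∷ r) , rs) ∷ pH)) ∷ []))
... | contracted Γ'' r q =
  mset-at G' H' (↭-sym q , ↭-refl)
    (∧l-rule B C G' (Γ'' ⊢ succ c') H' tt
      (drop-inverted (∧-inv B C) ih G' H' Γ'' (succ c')
        (contract-step A ih d (Pw.++⁺ pG ((contracts-∷ (contracts-∷ r) , rs) ∷ pH))) ∷ []))
contract-step A ih (∨r {G} {Γ} {Δ} {H} {B} {C} d) rel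
  with at {G'} {c'} {H'} pG (ra , rs) pH ← pointwiseAt G rel =
  mset-at G' H' (↭-refl , rs)
    (∨r-rule B C G' (ante c' ⊢ Δ) H' tt (contract-step A ih d (Pw.++⁺ pG ((ra , ↭-refl) ∷ pH)) ∷ []))
contract-step A ih (∧r {G} {Γ} {Δ} {H} {B} {C} d e) rel
  with at {G'} {c'} {H'} pG (ra , rs) pH ← pointwiseAt G rel =
  mset-at G' H' (↭-refl , rs)
    (∧r-rule B C G' (ante c' ⊢ Δ) H' tt
      (contract-step A ih d (Pw.++⁺ pG ((ra , ↭-refl) ∷ pH)) ∷
       contract-step A ih e (Pw.++⁺ pG ((ra , ↭-refl) ∷ pH)) ∷ []))
contract-step A ih (∨l {G} {Γ} {Δ} {H} {B} {C} d e) rel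
  with at {G'} {c'} {H'} pG (ra , rs) pH ← pointwiseAt G rel | contracts-view ra
... | kept Γ'' r q =
  mset-at G' H' (↭-sym q , ↭-refl)
    (∨l-rule B C G' (Γ'' ⊢ succ c') H' tt
      (contract-step A ih d (Pw.++⁺ pG ((contracts-∷ r , rs) ∷ pH)) ∷
       contract-step A ih e (Pw.++⁺ pG ((contracts-∷ r , rs) ∷ pH)) ∷ []))
... | contracted Γ'' r q =
  mset-at G' H' (↭-sym q , ↭-refl)
    (∨l-rule B C G' (Γ'' ⊢ succ c') H' tt
      (drop-inverted (∨-inv₁ B C) ih G' H' Γ'' (succ c')
         (contract-step A ih d (Pw.++⁺ pG ((contracts-∷ r , rs) ∷ pH))) ∷
       drop-inverted (∨-inv₂ B C) ih G' H' Γ'' (succ c')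
         (contract-step A ih e (Pw.++⁺ pG ((contracts-∷ r , rs) ∷ pH))) ∷ []))
contract-step A ih (⊃r₁ {G} {Γ} {Δ} {B} {C} d) rel with at {G'} {c'} pG (ra , rs) [] ← pointwiseAt G rel =
  mset-at G' [] (↭-refl , rs)
    (⊃r₁-rule B C G' (ante c') Δ tt
      (contract-step A ih d (Pw.++⁺ pG ((ra , ↭-refl) ∷ (contracts-refl , ↭-refl) ∷ []))))
contract-step A ih (⊃l {G} {Γ} {Δ} {H} {B} {C} d e) rel
  with at {G'} {c'} {H'} pG (ra , rs) pH ← pointwiseAt G rel | contracts-view ra
... | kept Γ'' r q =
  mset-at G' H' (↭-sym q , ↭-refl)
    (⊃l-rule B C G' (Γ'' ⊢ succ c') H' tt
      (contract-step A ih d (Pw.++⁺ pG ((contracts-∷ r , rs) ∷ pH)) ∷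
       contract-step A ih e (Pw.++⁺ pG ((contracts-∷ r , prep B rs) ∷ pH)) ∷ []))
... | contracted Γ'' r q =
  mset-at G' H' (↭-sym q , ↭-refl)
    (⊃l-rule B C G' (Γ'' ⊢ succ c') H' tt
      (drop-inverted (⊃-inv B C) ih G' H' Γ'' (succ c')
         (contract-step A ih d (Pw.++⁺ pG ((contracts-∷ r , rs) ∷ pH))) ∷
       contract-step A ih e (Pw.++⁺ pG ((contracts-respʳ ra q , prep B rs) ∷ pH)) ∷ []))
contract-step A ih (lift {G} {Γ₁} {Δ₁} {Γ₂} {Δ₂} {H} {P} d) rel
  with at {G'} {c₁'} {c₂' ∷ H'} pG (ra₁ , rs₁) ((ra₂ , rs₂) ∷ pH) ← pointwiseAt G rel
  with Γ₃ , g ← ∈⇒↭∷ (contracts-∈ ra₁)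
  = mset-at G' (c₂' ∷ H') (↭-sym g , ↭-refl)
      (lift-rule G' Γ₃ (succ c₁') (ante c₂') (succ c₂') H' P
        (contract-step A ih d
          (Pw.++⁺ pG ((contracts-respʳ ra₁ g , rs₁) ∷ (contracts-∷ ra₂ , rs₂) ∷ pH))))
contract-step A ih (∀l {G} {Γ} {Δ} {H} {x} {B} a d) rel
  with at {G'} {c'} {H'} pG (ra , rs) pH ← pointwiseAt G rel
  with Γ₃ , g ← ∈⇒↭∷ (contracts-∈ ra)
  = mset-at G' H' (↭-sym g , ↭-refl)
      (∀l-rule x B a G' (Γ₃ ⊢ succ c') H' tt
        (contract-step A ih d (Pw.++⁺ pG ((contracts-∷ (contracts-respʳ ra g) , rs) ∷ pH)) ∷ []))
contract-step A ih (∃r {G} {Γ} {Δ} {H} {x} {B} a d) rel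
  with at {G'} {c'} {H'} pG (ra , rs) pH ← pointwiseAt G rel =
  mset-at G' H' (↭-refl , rs)
    (∃r-rule x B a G' (ante c' ⊢ Δ) H' tt (contract-step A ih d (Pw.++⁺ pG ((ra , ↭-refl) ∷ pH)) ∷ []))
contract-step A ih (∃l {G} {Γ} {Δ} {H} {x} {B} a fr d) rel
  with at {G'} {c'} {H'} pG (ra , rs) pH ← pointwiseAt G rel | contracts-view ra
... | kept Γ'' r q =
  mset-at G' H' (↭-sym q , ↭-refl)
    (∃l-rule x B a G' (Γ'' ⊢ succ c') H'
      (Fresh-resp-≈ (≈-at G' H' (q , ↭-refl)) (Fresh-Contracted rel fr))
      (contract-step A ih d (Pw.++⁺ pG ((contracts-∷ r , rs) ∷ pH)) ∷ []))
... | contracted Γ'' r q =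
  mset-at G' H' (↭-sym q , ↭-refl)
    (∃l-rule x B a G' (Γ'' ⊢ succ c') H'
      (Fresh-resp-≈ (≈-at G' H' (q , ↭-refl)) (Fresh-Contracted rel fr))
      (drop-inverted (∃-inv x B a) ih G' H' Γ'' (succ c')
         (contract-step A ih d (Pw.++⁺ pG ((contracts-∷ r , rs) ∷ pH))) ∷ []))
contract-step A ih (∀r₁ {G} {Γ} {Δ} {x} {B} a fr d) rel
  with at {G'} {c'} pG (ra , rs) [] ← pointwiseAt G rel =
  mset-at G' [] (↭-refl , rs)
    (∀r₁-rule x B a G' (ante c') Δ
      (Fresh-resp-≈ (≈-at G' [] (↭-refl , ↭-sym rs)) (Fresh-Contracted rel fr))
      (contract-step A ih d (Pw.++⁺ pG ((ra , ↭-refl) ∷ (contracts-refl , ↭-refl) ∷ []))))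
contract-step A ih (⊃r₂ {G} {Γ₁} {Δ₁} {Γ₂} {Δ₂} {H} {B} {C} d e) rel
  with at {G'} {c₁'} {c₂' ∷ H'} pG (ra₁ , rs₁) ((ra₂ , rs₂) ∷ pH) ← pointwiseAt G rel =
  mset-at G' (c₂' ∷ H') (↭-refl , rs₁)
    (⊃r₂-rule B C G' (ante c₁') Δ₁ (ante c₂') (succ c₂') H' tt
      (contract-step A ih d
        (Pw.++⁺ pG ((ra₁ , ↭-refl) ∷ (contracts-refl , ↭-refl) ∷ (ra₂ , rs₂) ∷ pH)))
      (contract-step A ih e (Pw.++⁺ pG ((ra₁ , ↭-refl) ∷ (ra₂ , prep _ rs₂) ∷ pH))))
contract-step A ih (∀r₂ {G} {Γ₁} {Δ₁} {Γ₂} {Δ₂} {H} {x} {B} a fr d e) rel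
  with at {G'} {c₁'} {c₂' ∷ H'} pG (ra₁ , rs₁) ((ra₂ , rs₂) ∷ pH) ← pointwiseAt G rel =
  mset-at G' (c₂' ∷ H') (↭-refl , rs₁)
    (∀r₂-rule x B a G' (ante c₁') Δ₁ (ante c₂') (succ c₂') H'
      (Fresh-resp-≈ (≈-at G' (c₂' ∷ H') (↭-refl , ↭-sym rs₁)) (Fresh-Contracted rel fr))
      (contract-step A ih d
        (Pw.++⁺ pG ((ra₁ , ↭-refl) ∷ (contracts-refl , ↭-refl) ∷ (ra₂ , rs₂) ∷ pH)))
      (contract-step A ih e (Pw.++⁺ pG ((ra₁ , ↭-refl) ∷ (ra₂ , prep _ rs₂) ∷ pH))))

contract : ∀ A → Contractible A
contract = WF.All.wfRec (On.wellFounded size <-wellFounded) _ Contractible contract-step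

-- Merging adjacent components

mergeC : Comp → Comp → Comp
mergeC c₁ c₂ = (ante c₁ ++ ante c₂) ⊢ (succ c₁ ++ succ c₂)

mergeC-cong : ∀ {c₁ c₁' c₂ c₂'} → c₁ ≈C c₁' → c₂ ≈C c₂' → mergeC c₁ c₂ ≈C mergeC c₁' c₂'
mergeC-cong (p₁ , q₁) (p₂ , q₂) = ++⁺ p₁ p₂ , ++⁺ q₁ q₂

mergeC-comm : ∀ c₁ c₂ → mergeC c₁ c₂ ≈C mergeC c₂ c₁
mergeC-comm c₁ c₂ = ++-comm (ante c₁) (ante c₂) , ++-comm (succ c₁) (succ c₂)

◂-mergeC : ∀ s c₁ c₂ → mergeC (s ◂ c₁) c₂ ≈C (s ◂ mergeC c₁ c₂)
◂-mergeC (P , Q) c₁ c₂ = ++-assoc P (ante c₁) (ante c₂) , ++-assoc Q (succ c₁) (succ c₂)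

parsC-mergeC : ∀ c₁ c₂ → parsC (mergeC c₁ c₂) ⊆ parsC c₁ ++ parsC c₂
parsC-mergeC (Γ₁ ⊢ Δ₁) (Γ₂ ⊢ Δ₂) =
  ⊆.⊆-trans (⊆.⊆-reflexive (cong₂ _++_ (concatMap-++ parsF Γ₁ Γ₂) (concatMap-++ parsF Δ₁ Δ₂)))
            (⊆.⊆-reflexive-↭ (++-interchange (parsL Γ₁) (parsL Γ₂) (parsL Δ₁) (parsL Δ₂)))

data Merge : LNS → LNS → Set where
  here  : ∀ {c₁ c₂ c H H'} → mergeC c₁ c₂ ≈C c → H ≈S H' → Merge (c₁ ∷ c₂ ∷ H) (c ∷ H')
  there : ∀ {c c' S S'} → c ≈C c' → Merge S S' → Merge (c ∷ S) (c' ∷ S')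

Merge-respˡ : ∀ {S₀ S S'} → S₀ ≈S S → Merge S S' → Merge S₀ S'
Merge-respˡ (e₁ ∷ e₂ ∷ es) (here e pH) = here (≈C-trans (mergeC-cong e₁ e₂) e) (≈S-trans es pH)
Merge-respˡ (e₁ ∷ es)      (there e m) = there (≈C-trans e₁ e) (Merge-respˡ es m)

parsS-Merge : ∀ {S S'} → Merge S S' → parsS S' ⊆ parsS S
parsS-Merge {c₁ ∷ c₂ ∷ _} (here e pH) =
  ⊆.⊆-trans (⊆.++⁺ (⊆.⊆-trans (parsC-≈ e) (parsC-mergeC c₁ c₂)) (parsS-pointwise parsC-≈ pH))
            (⊆.⊆-reflexive-↭ (++-assoc (parsC c₁) (parsC c₂) _))
parsS-Merge (there e m) = ⊆.++⁺ (parsC-≈ e) (parsS-Merge m)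

Fresh-Merge : ∀ {a S S'} → Merge S S' → Fresh a S → Fresh a S'
Fresh-Merge m a∉ = a∉ ∘ parsS-Merge m

Merge-before : ∀ {G G' c c' H H'} → Merge G G' → c ≈C c' → H ≈S H' →
               Merge (G ++ c ∷ H) (G' ++ c' ∷ H')
Merge-before (here e pG) ec pH = here e (Pw.++⁺ pG (ec ∷ pH))
Merge-before (there e m) ec pH = there e (Merge-before m ec pH)

Merge-after : ∀ {G G' c c' H H'} → G ≈S G' → c ≈C c' → Merge H H' →
              Merge (G ++ c ∷ H) (G' ++ c' ∷ H')
Merge-after []       ec m = there ec m
Merge-after (e ∷ pG) ec m = there e (Merge-after pG ec m)

Merge-next : ∀ {G G' c c₂ m H H'} → G ≈S G' → mergeC c c₂ ≈C m → H ≈S H' →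
             Merge (G ++ c ∷ c₂ ∷ H) (G' ++ m ∷ H')
Merge-next []       em pH = here em pH
Merge-next (e ∷ pG) em pH = there e (Merge-next pG em pH)

Merge-prev : ∀ {G G' c₁ c m H H'} → G ≈S G' → mergeC c c₁ ≈C m → H ≈S H' →
             Merge ((G ++ c₁ ∷ []) ++ c ∷ H) (G' ++ m ∷ H')
Merge-prev {c₁ = c₁} {c} []       em pH = here (≈C-trans (mergeC-comm c₁ c) em) pH
Merge-prev              (e ∷ pG) em pH = there e (Merge-prev pG em pH)

data MergeAt (G : LNS) (c : Comp) (H : LNS) : LNS → Set where
  before    : ∀ {G' c' H'} → Merge G G' → c ≈C c' → H ≈S H' → MergeAt G c H (G' ++ c' ∷ H')
  after     : ∀ {G' c' H'} → G ≈S G' → c ≈C c' → Merge H H' → MergeAt G c H (G' ++ c' ∷ H')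
  with-next : ∀ {G' c₂ m H₀ H₀'} → H ≡ c₂ ∷ H₀ → G ≈S G' → mergeC c c₂ ≈C m → H₀ ≈S H₀' →
              MergeAt G c H (G' ++ m ∷ H₀')
  with-prev : ∀ {G₀ G₀' c₁ m H'} → G ≡ G₀ ++ c₁ ∷ [] → G₀ ≈S G₀' → mergeC c c₁ ≈C m → H ≈S H' →
              MergeAt G c H (G₀' ++ m ∷ H')

mergeAt : ∀ G {c H S'} → Merge (G ++ c ∷ H) S' → MergeAt G c H S'
mergeAt []                 (here e pH) = with-next refl [] e pH
mergeAt []                 (there e m) = after [] e m
mergeAt (c₁ ∷ [])      {c} (here e pH) = with-prev {G₀ = []} refl [] (≈C-trans (mergeC-comm c c₁) e) pH
mergeAt (_ ∷ _ ∷ G)        (here e pH) with at pG ec pH' ← pointwiseAt G pH = before (here e pG) ec pH'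
mergeAt (_ ∷ G)            (there e m) with mergeAt G m
... | before mG ec pH          = before (there e mG) ec pH
... | after pG ec mH           = after (e ∷ pG) ec mH
... | with-next eq pG em pH    = with-next eq (e ∷ pG) em pH
... | with-prev refl pG em pH  = with-prev refl (e ∷ pG) em pH

Always-Merge : ∀ {S S'} → Merge S S' → Always S → Always S'
Always-Merge _ _ = tt

merge-local : ∀ {Side prems concl} → LocalRule Side prems concl →
  (∀ {S S'} → Merge S S' → Side S → Side S') →
  ∀ G c H → Side (G ++ concl ◂ c ∷ H) → All (λ s → Admissible Merge (G ++ s ◂ c ∷ H)) prems →
  Admissible Merge (G ++ concl ◂ c ∷ H)
merge-local {concl = concl} rule stable G c H side ihs m with mergeAt G m
... | before {G' = G'} {c' = c'} {H' = H'} mG e pH =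
  mset-at G' H' e (local-rule-along rule stable (λ _ → Merge-before mG ≈C-refl pH) side ihs)
... | after {G' = G'} {c' = c'} {H' = H'} pG e mH =
  mset-at G' H' e (local-rule-along rule stable (λ _ → Merge-after pG ≈C-refl mH) side ihs)
... | with-next {G' = G'} {c₂ = c₂} {H₀' = H'} refl pG e pH =
  mset-at G' H' (≈C-trans (≈C-sym (◂-mergeC concl c c₂)) e)
    (local-rule-along rule stable (λ s → Merge-next pG (◂-mergeC s c c₂) pH) side ihs)
... | with-prev {G₀' = G'} {c₁ = c₁} {H' = H'} refl pG e pH =
  mset-at G' H' (≈C-trans (≈C-sym (◂-mergeC concl c c₁)) e)
    (local-rule-along rule stable (λ s → Merge-prev pG (◂-mergeC s c c₁) pH) side ihs)

merge-right₁ : ∀ {Side K P} → RightRule₁ Side K P → (∀ {S S'} → Merge S S' → Side S → Side S') →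
  ∀ G Γ Δ → Side (G ++ (Γ ⊢ (P ∷ Δ)) ∷ []) → Admissible Merge (G ++ (Γ ⊢ Δ) ∷ K ∷ []) →
  Admissible Merge (G ++ (Γ ⊢ (P ∷ Δ)) ∷ [])
merge-right₁ rule stable G Γ Δ side ih m with mergeAt G m
... | before {G' = G'} mG e [] =
  mset-at G' [] e
    (rule G' Γ Δ (stable (Merge-before mG ≈C-refl []) side) (ih (Merge-before mG ≈C-refl (≈C-refl ∷ []))))
... | with-prev {G₀' = G₀'} {c₁ = c₁} refl pG e [] =
  mset-at G₀' [] e
    (rule G₀' (Γ ++ ante c₁) (Δ ++ succ c₁) (stable (Merge-prev pG ≈C-refl []) side)
      (ih (Merge-prev pG ≈C-refl (≈C-refl ∷ []))))

merge-right₂ : ∀ {Side K P} → RightRule₂ Side K P → (∀ {S S'} → Merge S S' → Side S → Side S') →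
  ∀ G Γ₁ Δ₁ Γ₂ Δ₂ H → Side (G ++ (Γ₁ ⊢ (P ∷ Δ₁)) ∷ (Γ₂ ⊢ Δ₂) ∷ H) →
  Admissible Merge (G ++ (Γ₁ ⊢ Δ₁) ∷ K ∷ (Γ₂ ⊢ Δ₂) ∷ H) →
  Admissible Merge (G ++ (Γ₁ ⊢ Δ₁) ∷ (Γ₂ ⊢ (P ∷ Δ₂)) ∷ H) →
  Admissible Merge (G ++ (Γ₁ ⊢ (P ∷ Δ₁)) ∷ (Γ₂ ⊢ Δ₂) ∷ H)
merge-right₂ {P = P} rule stable G Γ₁ Δ₁ Γ₂ Δ₂ H side ih-d ih-e m with mergeAt G m
... | before {G' = G'} mG e₁ (_∷_ {ys = H'} e₂ pH) =
  mset-at₂ G' H' e₁ e₂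
    (rule G' Γ₁ Δ₁ Γ₂ Δ₂ H' (stable (Merge-before mG ≈C-refl (≈C-refl ∷ pH)) side)
      (ih-d (Merge-before mG ≈C-refl (≈C-refl ∷ ≈C-refl ∷ pH)))
      (ih-e (Merge-before mG ≈C-refl (≈C-refl ∷ pH))))
... | after {G' = G'} pG e₁ (there {S' = H'} e₂ mH) =
  mset-at₂ G' H' e₁ e₂
    (rule G' Γ₁ Δ₁ Γ₂ Δ₂ H' (stable (Merge-after pG ≈C-refl (there ≈C-refl mH)) side)
      (ih-d (Merge-after pG ≈C-refl (there ≈C-refl (there ≈C-refl mH))))
      (ih-e (Merge-after pG ≈C-refl (there ≈C-refl mH))))
... | after {G' = G'} pG e₁ (here {c₂ = c₃} {H' = H'} e₂ pH) =
  mset-at₂ G' H' e₁ e₂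
    (rule G' Γ₁ Δ₁ (Γ₂ ++ ante c₃) (Δ₂ ++ succ c₃) H'
      (stable (Merge-after pG ≈C-refl (here ≈C-refl pH)) side)
      (ih-d (Merge-after pG ≈C-refl (there ≈C-refl (here ≈C-refl pH))))
      (ih-e (Merge-after pG ≈C-refl (here ≈C-refl pH))))
... | with-next {G' = G'} {H₀' = H'} refl pG e pH =
  -- merging the two components of the second premise already gives the conclusion
  mset-at G' H' (≈C-trans (↭-refl , shift P Δ₁ Δ₂) e) (ih-e (Merge-next pG ≈C-refl pH))
... | with-prev {G₀' = G₀'} {c₁ = c₀} refl pG e (_∷_ {ys = H'} e₂ pH) =
  mset-at₂ G₀' H' e e₂
    (rule G₀' (Γ₁ ++ ante c₀) (Δ₁ ++ succ c₀) Γ₂ Δ₂ H'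
      (stable (Merge-prev pG ≈C-refl (≈C-refl ∷ pH)) side)
      (ih-d (Merge-prev pG ≈C-refl (≈C-refl ∷ ≈C-refl ∷ pH)))
      (ih-e (Merge-prev pG ≈C-refl (≈C-refl ∷ pH))))

merge-id₂-adjacent : ∀ G' Γ₁ Δ₁ H Γ₂ Δ₂ F p as {c R m R'} →
  H ++ (Γ₂ ⊢ (patom p as ∷ Δ₂)) ∷ F ≡ c ∷ R →
  mergeC ((patom p as ∷ Γ₁) ⊢ Δ₁) c ≈C m → R ≈S R' →
  LNIF (G' ++ m ∷ R')
merge-id₂-adjacent G' Γ₁ Δ₁ [] Γ₂ Δ₂ F p as {R' = R'} refl e pR =
  mset-at G' R' (≈C-trans (↭-refl , ↭-sym (shift (patom p as) Δ₁ Δ₂)) e)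
    (id₁ G' (Γ₁ ++ Γ₂) (Δ₁ ++ Δ₂) R' p as)
merge-id₂-adjacent G' Γ₁ Δ₁ (h ∷ H) Γ₂ Δ₂ F p as refl e pR
  with at {H'} {c₂'} {F'} pH e₂ pF ← pointwiseAt H pR =
  mset-at-both G' H' F' e e₂
    (id₂ G' (Γ₁ ++ ante h) (Δ₁ ++ succ h) H' Γ₂ Δ₂ F' p as)

merge-lift : ∀ G Γ₁ Δ₁ Γ₂ Δ₂ H A →
  Admissible Merge (G ++ ((A ∷ Γ₁) ⊢ Δ₁) ∷ ((A ∷ Γ₂) ⊢ Δ₂) ∷ H) →
  Admissible Merge (G ++ ((A ∷ Γ₁) ⊢ Δ₁) ∷ (Γ₂ ⊢ Δ₂) ∷ H)
merge-lift G Γ₁ Δ₁ Γ₂ Δ₂ H A ih m with mergeAt G m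
... | before {G' = G'} mG e₁ (_∷_ {ys = H'} e₂ pH) =
  mset-at₂ G' H' e₁ e₂ (lift-rule G' Γ₁ Δ₁ Γ₂ Δ₂ H' A (ih (Merge-before mG ≈C-refl (≈C-refl ∷ pH))))
... | after {G' = G'} pG e₁ (there {S' = H'} e₂ mH) =
  mset-at₂ G' H' e₁ e₂ (lift-rule G' Γ₁ Δ₁ Γ₂ Δ₂ H' A (ih (Merge-after pG ≈C-refl (there ≈C-refl mH))))
... | after {G' = G'} pG e₁ (here {c₂ = c₃} {H' = H'} e₂ pH) =
  mset-at₂ G' H' e₁ e₂
    (lift-rule G' Γ₁ Δ₁ (Γ₂ ++ ante c₃) (Δ₂ ++ succ c₃) H' A (ih (Merge-after pG ≈C-refl (here ≈C-refl pH))))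
... | with-next {G' = G'} {H₀' = H'} refl pG e pH =
  -- the lifted formula now occurs twice in the merged component
  mset-at G' H' e
    (drop-copy (contract A) G' H' (here refl)
      (mset-at G' H' (prep A (shift A Γ₁ Γ₂) , ↭-refl) (ih (Merge-next pG ≈C-refl pH))))
... | with-prev {G₀' = G₀'} {c₁ = c₀} refl pG e (_∷_ {ys = H'} e₂ pH) =
  mset-at₂ G₀' H' e e₂
    (lift-rule G₀' (Γ₁ ++ ante c₀) (Δ₁ ++ succ c₀) Γ₂ Δ₂ H' A (ih (Merge-prev pG ≈C-refl (≈C-refl ∷ pH))))

merge-id₂ : ∀ G Γ₁ Δ₁ H Γ₂ Δ₂ F p as →
  Admissible Merge (G ++ ((patom p as ∷ Γ₁) ⊢ Δ₁) ∷ H ++ (Γ₂ ⊢ (patom p as ∷ Δ₂)) ∷ F)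
merge-id₂ G Γ₁ Δ₁ H Γ₂ Δ₂ F p as m with mergeAt G m
... | before {G' = G'} mG e₁ rest with at {H'} {_} {F'} pH e₂ pF ← pointwiseAt H rest =
  mset-at-both G' H' F' e₁ e₂ (id₂ G' Γ₁ Δ₁ H' Γ₂ Δ₂ F' p as)
... | with-next {G' = G'} eq pG e pR = merge-id₂-adjacent G' Γ₁ Δ₁ H Γ₂ Δ₂ F p as eq e pR
... | with-prev {G₀' = G₀'} {c₁ = c₀} refl pG e rest with at {H'} {_} {F'} pH e₂ pF ← pointwiseAt H rest =
  mset-at-both G₀' H' F' e e₂ (id₂ G₀' (Γ₁ ++ ante c₀) (Δ₁ ++ succ c₀) H' Γ₂ Δ₂ F' p as)
... | after {G' = G'} pG e₁ mR with mergeAt H mR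
...   | before {G' = H'} {H' = F'} mH e₂ pF =
  mset-at-both G' H' F' e₁ e₂ (id₂ G' Γ₁ Δ₁ H' Γ₂ Δ₂ F' p as)
...   | after {G' = H'} {H' = F'} pH e₂ mF =
  mset-at-both G' H' F' e₁ e₂ (id₂ G' Γ₁ Δ₁ H' Γ₂ Δ₂ F' p as)
...   | with-next {G' = H'} {c₂ = f} {H₀' = F'} refl pH e₂ pF =
  mset-at-both G' H' F' e₁ e₂ (id₂ G' Γ₁ Δ₁ H' (Γ₂ ++ ante f) (Δ₂ ++ succ f) F' p as)
...   | with-prev {G₀' = H'} {c₁ = h} {H' = F'} refl pH e₂ pF =
  mset-at-both G' H' F' e₁ e₂ (id₂ G' Γ₁ Δ₁ H' (Γ₂ ++ ante h) (Δ₂ ++ succ h) F' p as)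

merge : ∀ {S} → LNIF S → Admissible Merge S
merge (mset e d) m = merge d (Merge-respˡ e m)
merge (id₁ G Γ Δ H p as) = merge-local (id₁-rule p as) Always-Merge G (Γ ⊢ Δ) H tt []
merge (id₂ G Γ₁ Δ₁ H Γ₂ Δ₂ F p as) = merge-id₂ G Γ₁ Δ₁ H Γ₂ Δ₂ F p as
merge (⊥l G Γ Δ H) = merge-local ⊥l-rule Always-Merge G (Γ ⊢ Δ) H tt []
merge (∧l {G} {Γ} {Δ} {H} {A} {B} d) =
  merge-local (∧l-rule A B) Always-Merge G (Γ ⊢ Δ) H tt (merge d ∷ [])
merge (∨r {G} {Γ} {Δ} {H} {A} {B} d) =
  merge-local (∨r-rule A B) Always-Merge G (Γ ⊢ Δ) H tt (merge d ∷ [])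
merge (∧r {G} {Γ} {Δ} {H} {A} {B} d e) =
  merge-local (∧r-rule A B) Always-Merge G (Γ ⊢ Δ) H tt (merge d ∷ merge e ∷ [])
merge (∨l {G} {Γ} {Δ} {H} {A} {B} d e) =
  merge-local (∨l-rule A B) Always-Merge G (Γ ⊢ Δ) H tt (merge d ∷ merge e ∷ [])
merge (⊃l {G} {Γ} {Δ} {H} {A} {B} d e) =
  merge-local (⊃l-rule A B) Always-Merge G (Γ ⊢ Δ) H tt (merge d ∷ merge e ∷ [])
merge (∀l {G} {Γ} {Δ} {H} {x} {A} a d) =
  merge-local (∀l-rule x A a) Always-Merge G (Γ ⊢ Δ) H tt (merge d ∷ [])
merge (∃r {G} {Γ} {Δ} {H} {x} {A} a d) =
  merge-local (∃r-rule x A a) Always-Merge G (Γ ⊢ Δ) H tt (merge d ∷ [])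
merge (∃l {G} {Γ} {Δ} {H} {x} {A} a fr d) =
  merge-local (∃l-rule x A a) Fresh-Merge G (Γ ⊢ Δ) H fr (merge d ∷ [])
merge (⊃r₁ {G} {Γ} {Δ} {A} {B} d) = merge-right₁ (⊃r₁-rule A B) Always-Merge G Γ Δ tt (merge d)
merge (∀r₁ {G} {Γ} {Δ} {x} {A} a fr d) = merge-right₁ (∀r₁-rule x A a) Fresh-Merge G Γ Δ fr (merge d)
merge (⊃r₂ {G} {Γ₁} {Δ₁} {Γ₂} {Δ₂} {H} {A} {B} d e) =
  merge-right₂ (⊃r₂-rule A B) Always-Merge G Γ₁ Δ₁ Γ₂ Δ₂ H tt (merge d) (merge e)
merge (∀r₂ {G} {Γ₁} {Δ₁} {Γ₂} {Δ₂} {H} {x} {A} a fr d e) =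
  merge-right₂ (∀r₂-rule x A a) Fresh-Merge G Γ₁ Δ₁ Γ₂ Δ₂ H fr (merge d) (merge e)
merge (lift {G} {Γ₁} {Δ₁} {Γ₂} {Δ₂} {H} {A} d) = merge-lift G Γ₁ Δ₁ Γ₂ Δ₂ H A (merge d)

lemma15 : ∀ (G H : LNS) (Γ₁ Δ₁ Γ₂ Δ₂ : List Formula) →
    ClosedS (G // [ Γ₁ ⊢ Δ₁ ] // [ Γ₂ ⊢ Δ₂ ] // H) →
    LNIF (G // [ Γ₁ ⊢ Δ₁ ] // [ Γ₂ ⊢ Δ₂ ] // H) →
    LNIF (G // [ (Γ₁ ++ Γ₂) ⊢ (Δ₁ ++ Δ₂) ] // H)
lemma15 G H Γ₁ Δ₁ Γ₂ Δ₂ _ d = merge d (Merge-next (≈S-refl {G}) ≈C-refl ≈S-refl)
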